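{- Let $a,b,d$ be noncommuting variables, i.e. free generators of a free group $F$, and let $M$ be the $2\times 2$ matrix with entries in $\mathbb{Z}F=\mathbb{Z}\langle a,a^{ -1},b,b^{ -1},d,d^{ -1}\rangle$ $$M=\begin{pmatrix} a+a^{ -1} & b\\ b^{ -1} & d+d^{ -1}\end{pmatrix}.$$ Then $$g_M=3\,\frac{(1-8t^2)^{1/2}-1+6t^2}{1-9t^2}\qquad\text{and}\qquad P_M=\frac{(1-8t^2)^{3/2}-1+12t^2-24t^4}{32t^6}.$$
   Context: For $x\in\mathbb{Z}F$ write $x=\sum_{g\in F}(x,g)g$. For $n\geq1$, $a_n(M)=(\mathrm{Tr}(M^n),1)$ is the coefficient of the identity element of $F$ in $\mathrm{Tr}(M^n)$. Then $g_M=\sum_{n\geq1}a_n(M)t^n$ and $P_M=\exp\big(\sum_{n\geq1}a_n(M)t^n/n\big)$, as formal power series in $t$; the square roots $(1-8t^2)^{1/2}$ and $(1-8t^2)^{3/2}$ denote the formal power series with constant term $1$. -}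

module Defs where

open import Data.Nat as ℕ using (ℕ; zero; suc)
open import Data.Integer as ℤ using (ℤ; +_)
open import Data.Rational as ℚ using (ℚ)
open import Data.Fin using (Fin; zero; suc)
open import Data.Bool using (Bool; true; false; not; _∧_; if_then_else_)
open import Data.Product using (_×_; _,_)
open import Data.List using (List; []; _∷_; _++_; concatMap; foldr)
open import Data.Fin.Properties using () renaming (_≟_ to _≟F_)
open import Data.Bool.Properties using () renaming (_≟_ to _≟B_)
open import Relation.Nullary.Decidable using (⌊_⌋)
open import Relation.Nullary using (yes; no)

-- A letter is a generator together with an exponent sign
-- (true = g, false = g⁻¹).  Group elements are represented by words;
-- two words represent the same element of F iff they have the same
-- free reduction.

Gen : Set
Gen = Fin 3

gA gB gD : Gen
gA = zero
gB = suc zero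
gD = suc (suc zero)

Letter : Set
Letter = Gen × Bool

Word : Set
Word = List Letter

inverseLetters : Letter → Letter → Bool
inverseLetters (g , s) (h , t) = ⌊ g ≟F h ⌋ ∧ not ⌊ s ≟B t ⌋

pushLetter : Letter → Word → Word
pushLetter x [] = x ∷ []
pushLetter x (y ∷ ys) = if inverseLetters x y then ys else x ∷ y ∷ ys

reduce : Word → Word
reduce = foldr pushLetter []

isIdentity : Word → Bool
isIdentity w with reduce w
... | [] = true
... | _ ∷ _ = false

-- The group ring ℤF.  An element is a finite formal sum Σ cᵢ·wᵢ,
-- represented as a list of (coefficient, word) pairs; the ring
-- operations are the induced ones.  (x , 1) is then well defined.

ZF : Set
ZF = List (ℤ × Word)

0F : ZF
0F = []

1F : ZF
1F = (+ 1 , []) ∷ []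

gen : Gen → ZF
gen g = (+ 1 , (g , true) ∷ []) ∷ []

genInv : Gen → ZF
genInv g = (+ 1 , (g , false) ∷ []) ∷ []

_+F_ : ZF → ZF → ZF
x +F y = x ++ y

_*F_ : ZF → ZF → ZF
x *F y = concatMap (λ { (c , v) → concatMap (λ { (c' , w) → (c ℤ.* c' , v ++ w) ∷ [] }) y }) x

coeffId : ZF → ℤ
coeffId [] = + 0
coeffId ((c , w) ∷ x) = (if isIdentity w then c else + 0) ℤ.+ coeffId x

Mat : Set
Mat = Fin 2 → Fin 2 → ZF

idMat : Mat
idMat zero zero = 1F
idMat (suc zero) (suc zero) = 1F
idMat _ _ = 0F

_*M_ : Mat → Mat → Mat
(A *M B) i j = (A i zero *F B zero j) +F (A i (suc zero) *F B (suc zero) j)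

_^M_ : Mat → ℕ → Mat
A ^M zero = idMat
A ^M suc n = A *M (A ^M n)

Tr : Mat → ZF
Tr A = A zero zero +F A (suc zero) (suc zero)

M : Mat
M zero zero = gen gA +F genInv gA
M zero (suc zero) = gen gB
M (suc zero) zero = genInv gB
M (suc zero) (suc zero) = gen gD +F genInv gD

aCoeff : Mat → ℕ → ℤ
aCoeff A n = coeffId (Tr (A ^M n))

Series : Set
Series = ℕ → ℚ

sumTo : ℕ → (ℕ → ℚ) → ℚ
sumTo zero f = f 0
sumTo (suc n) f = sumTo n f ℚ.+ f (suc n)

_⊛_ : Series → Series → Series
(f ⊛ g) n = sumTo n (λ k → f k ℚ.* g (n ℕ.∸ k))

_⊕_ : Series → Series → Series
(f ⊕ g) n = f n ℚ.+ g n

_⊖_ : Series → Series → Series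
(f ⊖ g) n = f n ℚ.- g n

scale : ℚ → Series → Series
scale c f n = c ℚ.* f n

powS : Series → ℕ → Series
powS f zero = λ { zero → ℚ.1ℚ ; (suc _) → ℚ.0ℚ }
powS f (suc k) = f ⊛ powS f k

mono : ℚ → ℕ → Series
mono c m n with n ℕ.≟ m
... | yes _ = c
... | no _ = ℚ.0ℚ

fromℤ : ℤ → ℚ
fromℤ z = z ℚ./ 1

fromℕ : ℕ → ℚ
fromℕ n = fromℤ (+ n)

invFact : ℕ → ℚ
invFact zero = ℚ.1ℚ
invFact (suc k) = invFact k ℚ.* ((+ 1) ℚ./ suc k)

binom : ℚ → ℕ → ℚ
binom α zero = ℚ.1ℚ
binom α (suc k) = binom α k ℚ.* (α ℚ.- fromℕ k) ℚ.* ((+ 1) ℚ./ suc k)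

-- exp(f) for a series f with zero constant term:  Σ_k f^k / k!
expS : Series → Series
expS f n = sumTo n (λ k → invFact k ℚ.* powS f k n)

-- (1 + f)^α for a series f with zero constant term:  Σ_k binom(α,k) f^k
-- (the formal power series with constant term 1)
binomPow : ℚ → Series → Series
binomPow α f n = sumTo n (λ k → binom α k ℚ.* powS f k n)

gS : Mat → Series
gS A zero = ℚ.0ℚ
gS A (suc n) = fromℤ (aCoeff A (suc n))

logP : Mat → Series
logP A zero = ℚ.0ℚ
logP A (suc n) = aCoeff A (suc n) ℚ./ suc n

PS : Mat → Series
PS A = expS (logP A)

sqrt18 : Series
sqrt18 = binomPow ((+ 1) ℚ./ 2) (mono (fromℤ (ℤ.- (+ 8))) 2)

pow32-18 : Series
pow32-18 = binomPow ((+ 3) ℚ./ 2) (mono (fromℤ (ℤ.- (+ 8))) 2)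

series1 : Series
series1 = mono ℚ.1ℚ 0

-- A letter of row i of M leads from vertex i to a vertex of the graph on {0, 1} with
-- loops a^±1, d^±1 and edges b, b⁻¹, and each vertex has three outgoing letters.  Hence
-- the coefficient of a reduced word u in (Mⁿ)ᵢⱼ is the number wₙ,|u| of n-step walks
-- between two vertices at distance |u| in the 3-regular tree (or 0 if u is not a path
-- i → j), and aₙ = 2wₙ,₀.  With C = (1 − (1 − 8t²)^{1/2}) / 4t², so C = 1 + 2t²C², the
-- series Σₙ wₙ,ₖ tⁿ is (tC)ᵏ R where R = 1 + 3t²CR; eliminating R and C gives g_M.
-- For P_M, θ = t d/dt turns P = exp(Σ aₙtⁿ/n) into θP = g P, and the claimed closed form
-- satisfies the same equation; after multiplying by 1 − 9t², solutions of such
-- first-order equations are determined by their constant term.  Identities for the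
-- binomial series (1 − 8t²)^{α} are proved the same way from (1 − 8t²)θU = −16αt²U.

module Submission where

open import Defs
open import Data.Nat using (ℕ)
open import Data.Product using (_×_; _,_)
open import Relation.Binary.PropositionalEquality using (_≡_)

module Rationals where

  open import Data.Nat as ℕ using (suc)
  open import Data.Integer as ℤ using (+_)
  import Data.Integer.Properties as ℤ
  open import Data.Integer.Tactic.RingSolver using () renaming (solve-∀ to solveℤ-∀)
  open import Data.Rational as ℚ using (0ℚ; 1ℚ; _+_; _*_; -_; toℚᵘ)
  open import Data.Rational.Properties
  import Data.Rational.Unnormalised as ℚᵘ
  import Data.Rational.Unnormalised.Properties as ℚᵘ
  open import Data.Maybe using (Maybe; just; nothing)
  open import Relation.Nullary using (yes; no)
  open import Relation.Binary.PropositionalEquality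
  open import Tactic.RingSolver.Core.AlmostCommutativeRing using (AlmostCommutativeRing; fromCommutativeRing)
  open import Defs using (fromℤ; fromℕ)

  ℚ-ring : AlmostCommutativeRing _ _
  ℚ-ring = fromCommutativeRing +-*-commutativeRing isZero
    where
    isZero : ∀ x → Maybe (0ℚ ≡ x)
    isZero x with 0ℚ ≟ x
    ... | yes p = just p
    ... | no _ = nothing

  toℚᵘ-fromℤ : ∀ z → toℚᵘ (fromℤ z) ℚᵘ.≃ ℚᵘ.mkℚᵘ z 0
  toℚᵘ-fromℤ z = toℚᵘ-fromℚᵘ (ℚᵘ.mkℚᵘ z 0)

  fromℤ-+ : ∀ x y → fromℤ (x ℤ.+ y) ≡ fromℤ x + fromℤ y
  fromℤ-+ x y = toℚᵘ-injective (begin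
    toℚᵘ (fromℤ (x ℤ.+ y))                ≈⟨ toℚᵘ-fromℤ (x ℤ.+ y) ⟩
    ℚᵘ.mkℚᵘ (x ℤ.+ y) 0                   ≈⟨ ℚᵘ.*≡* (cross x y) ⟩
    ℚᵘ.mkℚᵘ x 0 ℚᵘ.+ ℚᵘ.mkℚᵘ y 0          ≈⟨ ℚᵘ.+-cong (toℚᵘ-fromℤ x) (toℚᵘ-fromℤ y) ⟨
    toℚᵘ (fromℤ x) ℚᵘ.+ toℚᵘ (fromℤ y)    ≈⟨ toℚᵘ-homo-+ (fromℤ x) (fromℤ y) ⟨
    toℚᵘ (fromℤ x + fromℤ y)              ∎)
    where
    cross : ∀ x y → (x ℤ.+ y) ℤ.* + 1 ≡ (x ℤ.* + 1 ℤ.+ y ℤ.* + 1) ℤ.* + 1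
    cross = solveℤ-∀
    open import Relation.Binary.Reasoning.Setoid ℚᵘ.≃-setoid

  fromℤ-* : ∀ x y → fromℤ (x ℤ.* y) ≡ fromℤ x * fromℤ y
  fromℤ-* x y = toℚᵘ-injective (begin
    toℚᵘ (fromℤ (x ℤ.* y))                ≈⟨ toℚᵘ-fromℤ (x ℤ.* y) ⟩
    ℚᵘ.mkℚᵘ (x ℤ.* y) 0                   ≈⟨ ℚᵘ.*≡* (cross x y) ⟩
    ℚᵘ.mkℚᵘ x 0 ℚᵘ.* ℚᵘ.mkℚᵘ y 0          ≈⟨ ℚᵘ.*-cong (toℚᵘ-fromℤ x) (toℚᵘ-fromℤ y) ⟨
    toℚᵘ (fromℤ x) ℚᵘ.* toℚᵘ (fromℤ y)    ≈⟨ toℚᵘ-homo-* (fromℤ x) (fromℤ y) ⟨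
    toℚᵘ (fromℤ x * fromℤ y)              ∎)
    where
    cross : ∀ x y → (x ℤ.* y) ℤ.* + 1 ≡ (x ℤ.* y) ℤ.* + 1
    cross = solveℤ-∀
    open import Relation.Binary.Reasoning.Setoid ℚᵘ.≃-setoid

  fromℤ-neg : ∀ x → fromℤ (ℤ.- x) ≡ - fromℤ x
  fromℤ-neg x = toℚᵘ-injective (begin
    toℚᵘ (fromℤ (ℤ.- x))    ≈⟨ toℚᵘ-fromℤ (ℤ.- x) ⟩
    ℚᵘ.mkℚᵘ (ℤ.- x) 0       ≈⟨ ℚᵘ.-‿cong (toℚᵘ-fromℤ x) ⟨
    ℚᵘ.- toℚᵘ (fromℤ x)     ≈⟨ toℚᵘ-homo‿- (fromℤ x) ⟨
    toℚᵘ (- fromℤ x)        ∎)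
    where open import Relation.Binary.Reasoning.Setoid ℚᵘ.≃-setoid

  fromℕ-+ : ∀ m n → fromℕ (m ℕ.+ n) ≡ fromℕ m + fromℕ n
  fromℕ-+ m n = trans (cong fromℤ (ℤ.pos-+ m n)) (fromℤ-+ (+ m) (+ n))

  fromℕ-*-/ : ∀ z n → fromℕ (suc n) * (z ℚ./ suc n) ≡ fromℤ z
  fromℕ-*-/ z n = toℚᵘ-injective (begin
    toℚᵘ (fromℕ (suc n) * (z ℚ./ suc n))              ≈⟨ toℚᵘ-homo-* (fromℕ (suc n)) (z ℚ./ suc n) ⟩
    toℚᵘ (fromℕ (suc n)) ℚᵘ.* toℚᵘ (z ℚ./ suc n)      ≈⟨ ℚᵘ.*-cong (toℚᵘ-fromℤ (+ suc n)) (toℚᵘ-fromℚᵘ (ℚᵘ.mkℚᵘ z n)) ⟩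
    ℚᵘ.mkℚᵘ (+ suc n) 0 ℚᵘ.* ℚᵘ.mkℚᵘ z n              ≈⟨ ℚᵘ.*≡* (cross z (+ suc n)) ⟩
    ℚᵘ.mkℚᵘ z 0                                       ≈⟨ toℚᵘ-fromℤ z ⟨
    toℚᵘ (fromℤ z)                                    ∎)
    where
    cross : ∀ z m → (m ℤ.* z) ℤ.* + 1 ≡ z ℤ.* (+ 1 ℤ.* m)
    cross = solveℤ-∀
    open import Relation.Binary.Reasoning.Setoid ℚᵘ.≃-setoid

  fromℕ-*-inverse : ∀ n → fromℕ (suc n) * ((+ 1) ℚ./ suc n) ≡ 1ℚ
  fromℕ-*-inverse n = fromℕ-*-/ (+ 1) n

  fromℕ-*-cancel : ∀ n x → fromℕ (suc n) * x ≡ 0ℚ → x ≡ 0ℚ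
  fromℕ-*-cancel n x nx≡0 = begin
    x                        ≡⟨ *-identityˡ x ⟨
    1ℚ * x                   ≡⟨ cong (_* x) (trans (*-comm n⁻¹ (fromℕ (suc n))) (fromℕ-*-inverse n)) ⟨
    (n⁻¹ * fromℕ (suc n)) * x ≡⟨ *-assoc n⁻¹ (fromℕ (suc n)) x ⟩
    n⁻¹ * (fromℕ (suc n) * x) ≡⟨ cong (n⁻¹ *_) nx≡0 ⟩
    n⁻¹ * 0ℚ                 ≡⟨ *-zeroʳ n⁻¹ ⟩
    0ℚ                       ∎
    where
    n⁻¹ = (+ 1) ℚ./ suc n
    open ≡-Reasoning

module FiniteSums where

  open import Data.Nat as ℕ using (ℕ; zero; suc; _≤_; _<_; z≤n; s≤s; _∸_)
  import Data.Nat.Properties as ℕ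
  open import Data.Rational using (ℚ; 0ℚ; _+_; _*_)
  open import Data.Rational.Properties
  open import Algebra.Bundles using (CommutativeMonoid)
  open import Relation.Binary.PropositionalEquality
  open import Relation.Nullary using (yes; no)
  open import Algebra.Properties.CommutativeSemigroup
    (CommutativeMonoid.commutativeSemigroup +-0-commutativeMonoid)
    using () renaming (interchange to +-interchange)
  open import Defs using (sumTo)

  sumTo-cong : ∀ n {f g} → (∀ k → k ≤ n → f k ≡ g k) → sumTo n f ≡ sumTo n g
  sumTo-cong zero f≡g = f≡g 0 z≤n
  sumTo-cong (suc n) f≡g =
    cong₂ _+_ (sumTo-cong n (λ k k≤n → f≡g k (ℕ.m≤n⇒m≤1+n k≤n))) (f≡g (suc n) ℕ.≤-refl)

  sumTo-distrib-+ : ∀ n f g → sumTo n (λ k → f k + g k) ≡ sumTo n f + sumTo n g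
  sumTo-distrib-+ zero f g = refl
  sumTo-distrib-+ (suc n) f g = begin
    sumTo n (λ k → f k + g k) + (f (suc n) + g (suc n))
      ≡⟨ cong (_+ (f (suc n) + g (suc n))) (sumTo-distrib-+ n f g) ⟩
    (sumTo n f + sumTo n g) + (f (suc n) + g (suc n))
      ≡⟨ +-interchange (sumTo n f) (sumTo n g) (f (suc n)) (g (suc n)) ⟩
    (sumTo n f + f (suc n)) + (sumTo n g + g (suc n)) ∎
    where open ≡-Reasoning

  *-distribˡ-sumTo : ∀ n c f → c * sumTo n f ≡ sumTo n (λ k → c * f k)
  *-distribˡ-sumTo zero c f = refl
  *-distribˡ-sumTo (suc n) c f =
    trans (*-distribˡ-+ c (sumTo n f) (f (suc n))) (cong (_+ (c * f (suc n))) (*-distribˡ-sumTo n c f))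

  *-distribʳ-sumTo : ∀ n c f → sumTo n f * c ≡ sumTo n (λ k → f k * c)
  *-distribʳ-sumTo n c f = trans (*-comm (sumTo n f) c)
    (trans (*-distribˡ-sumTo n c f) (sumTo-cong n (λ k _ → *-comm c (f k))))

  sumTo-zero : ∀ n f → (∀ k → k ≤ n → f k ≡ 0ℚ) → sumTo n f ≡ 0ℚ
  sumTo-zero n f f≡0 = trans (sumTo-cong n f≡0) (sumTo-0ℚ n)
    where
    sumTo-0ℚ : ∀ n → sumTo n (λ _ → 0ℚ) ≡ 0ℚ
    sumTo-0ℚ zero = refl
    sumTo-0ℚ (suc n) = cong (_+ 0ℚ) (sumTo-0ℚ n)

  sumTo-suc : ∀ n f → sumTo (suc n) f ≡ f 0 + sumTo n (λ k → f (suc k))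
  sumTo-suc zero f = refl
  sumTo-suc (suc n) f = trans (cong (_+ f (suc (suc n))) (sumTo-suc n f)) (+-assoc (f 0) _ _)

  sumTo-reverse : ∀ n f → sumTo n f ≡ sumTo n (λ k → f (n ∸ k))
  sumTo-reverse zero f = refl
  sumTo-reverse (suc n) f = begin
    sumTo n f + f (suc n)                      ≡⟨ cong (_+ f (suc n)) (sumTo-reverse n f) ⟩
    sumTo n (λ k → f (n ∸ k)) + f (suc n)      ≡⟨ +-comm (sumTo n (λ k → f (n ∸ k))) (f (suc n)) ⟩
    f (suc n) + sumTo n (λ k → f (n ∸ k))      ≡⟨ sumTo-suc n (λ k → f (suc n ∸ k)) ⟨
    sumTo (suc n) (λ k → f (suc n ∸ k))        ∎
    where open ≡-Reasoning

  sumTo-singleton : ∀ n m f → m ≤ n → (∀ k → k ≢ m → f k ≡ 0ℚ) → sumTo n f ≡ f m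
  sumTo-singleton zero .zero f z≤n _ = refl
  sumTo-singleton (suc n) m f m≤1+n f≡0 with m ℕ.≟ suc n
  ... | yes refl = trans (cong (_+ f (suc n)) (sumTo-zero n f below)) (+-identityˡ _)
    where
    below : ∀ k → k ≤ n → f k ≡ 0ℚ
    below k k≤n = f≡0 k (λ { refl → ℕ.<-irrefl refl (s≤s k≤n) })
  ... | no m≢1+n = trans (cong₂ _+_ (sumTo-singleton n m f (ℕ.≤-pred (ℕ.≤∧≢⇒< m≤1+n m≢1+n)) f≡0)
                                    (f≡0 (suc n) (m≢1+n ∘ sym)))
                         (+-identityʳ _)
    where open import Function using (_∘_)

  sumTo-pad : ∀ n m f → n ≤ m → (∀ k → n < k → f k ≡ 0ℚ) → sumTo m f ≡ sumTo n f
  sumTo-pad n m f n≤m f≡0 = begin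
    sumTo m f                 ≡⟨ cong (λ l → sumTo l f) (ℕ.m+[n∸m]≡n n≤m) ⟨
    sumTo (n ℕ.+ (m ∸ n)) f   ≡⟨ pad (m ∸ n) ⟩
    sumTo n f                 ∎
    where
    open ≡-Reasoning
    pad : ∀ d → sumTo (n ℕ.+ d) f ≡ sumTo n f
    pad zero = cong (λ l → sumTo l f) (ℕ.+-identityʳ n)
    pad (suc d) rewrite ℕ.+-suc n d =
      trans (cong (sumTo (n ℕ.+ d) f +_) (f≡0 (suc (n ℕ.+ d)) (s≤s (ℕ.m≤m+n n d))))
            (trans (+-identityʳ _) (pad d))

  sumTo-swap : ∀ n m (g : ℕ → ℕ → ℚ) →
               sumTo n (λ i → sumTo m (g i)) ≡ sumTo m (λ j → sumTo n (λ i → g i j))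
  sumTo-swap zero m g = refl
  sumTo-swap (suc n) m g = trans (cong (_+ sumTo m (g (suc n))) (sumTo-swap n m g))
                                 (sym (sumTo-distrib-+ m (λ j → sumTo n (λ i → g i j)) (g (suc n))))

  sumTo-triangle : ∀ n (g : ℕ → ℕ → ℚ) →
                   sumTo n (λ k → sumTo k (λ i → g i (k ∸ i))) ≡ sumTo n (λ i → sumTo (n ∸ i) (g i))
  sumTo-triangle zero g = refl
  sumTo-triangle (suc n) g = begin
    sumTo n (λ k → sumTo k (λ i → g i (k ∸ i))) + sumTo (suc n) (λ i → g i (suc n ∸ i))
      ≡⟨ cong (_+ sumTo (suc n) (λ i → g i (suc n ∸ i))) (sumTo-triangle n g) ⟩
    A + (B + g (suc n) (n ∸ n))
      ≡⟨ +-assoc A B _ ⟨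
    (A + B) + g (suc n) (n ∸ n)
      ≡⟨ cong₂ _+_ (sumTo-distrib-+ n (λ i → sumTo (n ∸ i) (g i)) (λ i → g i (suc n ∸ i)))
                   (cong (g (suc n)) (sym (ℕ.n∸n≡0 n))) ⟨
    sumTo n (λ i → sumTo (n ∸ i) (g i) + g i (suc n ∸ i)) + g (suc n) 0
      ≡⟨ cong₂ _+_ (sumTo-cong n extend) (cong (λ l → sumTo l (g (suc n))) (ℕ.n∸n≡0 n)) ⟨
    sumTo n (λ i → sumTo (suc n ∸ i) (g i)) + sumTo (n ∸ n) (g (suc n)) ∎
    where
    open ≡-Reasoning
    A = sumTo n (λ i → sumTo (n ∸ i) (g i))
    B = sumTo n (λ i → g i (suc n ∸ i))
    extend : ∀ i → i ≤ n → sumTo (suc n ∸ i) (g i) ≡ sumTo (n ∸ i) (g i) + g i (suc n ∸ i)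
    extend i i≤n rewrite ℕ.+-∸-assoc 1 i≤n = refl

module PowerSeries where

  open import Data.Nat as ℕ using (ℕ; zero; suc; _≤_; _<_; s≤s; _∸_)
  open import Data.Nat.Induction using (<-rec)
  import Data.Nat.Properties as ℕ
  open import Data.Integer as ℤ using (ℤ; +_)
  open import Data.Rational using (ℚ; 0ℚ; 1ℚ; _+_; _*_; -_)
  open import Data.Rational.Properties
  open import Data.Product using (_,_)
  open import Data.Maybe using (Maybe; just; nothing)
  open import Relation.Binary.PropositionalEquality
  open import Relation.Binary.Structures using (IsEquivalence)
  open import Relation.Nullary using (yes; no)
  open import Data.Empty using (⊥-elim)
  open import Algebra.Structures using (IsCommutativeRing)
  open import Algebra.Bundles using (CommutativeRing)
  import Algebra.Solver.Ring.AlmostCommutativeRing as ACR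
  open import Defs
  open Rationals
  open FiniteSums

  infix 4 _≋_
  _≋_ : Series → Series → Set
  f ≋ g = ∀ n → f n ≡ g n

  0S : Series
  0S _ = 0ℚ

  negS : Series → Series
  negS f n = - f n

  const : ℚ → Series
  const c = mono c 0

  cst : ℤ → Series
  cst z = const (fromℤ z)

  infix 25 t^_
  t^_ : ℕ → Series
  t^ m = mono 1ℚ m

  t² : Series
  t² = t^ 2

  mono-same : ∀ c m → mono c m m ≡ c
  mono-same c m with m ℕ.≟ m
  ... | yes _ = refl
  ... | no m≢m = ⊥-elim (m≢m refl)

  mono-other : ∀ c m k → k ≢ m → mono c m k ≡ 0ℚ
  mono-other c m k k≢m with k ℕ.≟ m
  ... | yes k≡m = ⊥-elim (k≢m k≡m)
  ... | no _ = refl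

  mono-⊛-below : ∀ c m f n → n < m → (mono c m ⊛ f) n ≡ 0ℚ
  mono-⊛-below c m f n n<m = sumTo-zero n _ vanish
    where
    vanish : ∀ k → k ≤ n → mono c m k * f (n ∸ k) ≡ 0ℚ
    vanish k k≤n = trans (cong (_* f (n ∸ k)) (mono-other c m k (λ { refl → ℕ.<-irrefl refl (ℕ.≤-<-trans k≤n n<m) })))
                         (*-zeroˡ (f (n ∸ k)))

  mono-⊛-shift : ∀ c m f n → (mono c m ⊛ f) (m ℕ.+ n) ≡ c * f n
  mono-⊛-shift c m f n =
    trans (sumTo-singleton (m ℕ.+ n) m _ (ℕ.m≤m+n m n)
            (λ k k≢m → trans (cong (_* f (m ℕ.+ n ∸ k)) (mono-other c m k k≢m)) (*-zeroˡ (f (m ℕ.+ n ∸ k)))))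
          (cong₂ _*_ (mono-same c m) (cong f (ℕ.m+n∸m≡n m n)))

  ≋-mono-⊛ : ∀ c m {f g} → (∀ n → n < m → f n ≡ 0ℚ) → (∀ n → f (m ℕ.+ n) ≡ c * g n) → f ≋ (mono c m ⊛ g)
  ≋-mono-⊛ c m {f} {g} below shifted n with m ℕ.≤? n
  ... | yes m≤n = subst (λ k → f k ≡ (mono c m ⊛ g) k) (ℕ.m+[n∸m]≡n m≤n)
                        (trans (shifted (n ∸ m)) (sym (mono-⊛-shift c m g (n ∸ m))))
  ... | no m≰n = trans (below n (ℕ.≰⇒> m≰n)) (sym (mono-⊛-below c m g n (ℕ.≰⇒> m≰n)))

  const-⊛ : ∀ c f n → (const c ⊛ f) n ≡ c * f n
  const-⊛ c f n = mono-⊛-shift c 0 f n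

  ⊛-comm : ∀ f g → (f ⊛ g) ≋ (g ⊛ f)
  ⊛-comm f g n = trans (sumTo-reverse n _) (sumTo-cong n swap)
    where
    swap : ∀ k → k ≤ n → f (n ∸ k) * g (n ∸ (n ∸ k)) ≡ g k * f (n ∸ k)
    swap k k≤n = trans (*-comm (f (n ∸ k)) _) (cong (λ i → g i * f (n ∸ k)) (ℕ.m∸[m∸n]≡n k≤n))

  ⊛-assoc : ∀ f g h → ((f ⊛ g) ⊛ h) ≋ (f ⊛ (g ⊛ h))
  ⊛-assoc f g h n = begin
    sumTo n (λ k → sumTo k (λ i → f i * g (k ∸ i)) * h (n ∸ k))
      ≡⟨ sumTo-cong n (λ k k≤n → trans (*-distribʳ-sumTo k (h (n ∸ k)) (λ i → f i * g (k ∸ i)))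
                                        (sumTo-cong k (reassociate k))) ⟩
    sumTo n (λ k → sumTo k (λ i → G i (k ∸ i)))
      ≡⟨ sumTo-triangle n G ⟩
    sumTo n (λ i → sumTo (n ∸ i) (G i))
      ≡⟨ sumTo-cong n (λ i _ → sym (*-distribˡ-sumTo (n ∸ i) (f i) (λ j → g j * h (n ∸ i ∸ j)))) ⟩
    sumTo n (λ i → f i * sumTo (n ∸ i) (λ j → g j * h (n ∸ i ∸ j))) ∎
    where
    open ≡-Reasoning
    G : ℕ → ℕ → ℚ
    G i j = f i * (g j * h (n ∸ i ∸ j))
    reassociate : ∀ k i → i ≤ k → f i * g (k ∸ i) * h (n ∸ k) ≡ G i (k ∸ i)
    reassociate k i i≤k = trans (*-assoc (f i) (g (k ∸ i)) (h (n ∸ k)))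
      (cong (λ l → f i * (g (k ∸ i) * h l))
            (trans (cong (n ∸_) (sym (ℕ.m+[n∸m]≡n i≤k))) (sym (ℕ.∸-+-assoc n i (k ∸ i)))))

  ⊛-distribˡ-⊕ : ∀ f g h → (f ⊛ (g ⊕ h)) ≋ ((f ⊛ g) ⊕ (f ⊛ h))
  ⊛-distribˡ-⊕ f g h n =
    trans (sumTo-cong n (λ k _ → *-distribˡ-+ (f k) (g (n ∸ k)) (h (n ∸ k)))) (sumTo-distrib-+ n _ _)

  ⊛-identityˡ : ∀ f → (series1 ⊛ f) ≋ f
  ⊛-identityˡ f n = trans (const-⊛ 1ℚ f n) (*-identityˡ (f n))

  ⊛-cong : ∀ {f f′ g g′} → f ≋ f′ → g ≋ g′ → (f ⊛ g) ≋ (f′ ⊛ g′)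
  ⊛-cong f≋f′ g≋g′ n = sumTo-cong n (λ k _ → cong₂ _*_ (f≋f′ k) (g≋g′ (n ∸ k)))

  powS-zero : ∀ f → powS f 0 ≋ series1
  powS-zero f zero = refl
  powS-zero f (suc n) = refl

  ⊛-lowest : ∀ n f g → (∀ k → k < n → f k ≡ 0ℚ) → (f ⊛ g) n ≡ f n * g 0
  ⊛-lowest zero f g _ = refl
  ⊛-lowest (suc m) f g f≡0 = begin
    sumTo m (λ k → f k * g (suc m ∸ k)) + f (suc m) * g (m ∸ m)
      ≡⟨ cong₂ _+_ (sumTo-zero m _ (λ k k≤m → trans (cong (_* g (suc m ∸ k)) (f≡0 k (s≤s k≤m))) (*-zeroˡ (g (suc m ∸ k)))))
                   (cong (λ i → f (suc m) * g i) (ℕ.n∸n≡0 m)) ⟩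
    0ℚ + f (suc m) * g 0 ≡⟨ +-identityˡ _ ⟩
    f (suc m) * g 0      ∎
    where open ≡-Reasoning

  ⊛-unit-cancelʳ : ∀ f g → g 0 ≡ 1ℚ → (f ⊛ g) ≋ 0S → f ≋ 0S
  ⊛-unit-cancelʳ f g g₀≡1 fg≋0 = <-rec (λ k → f k ≡ 0ℚ) step
    where
    step : ∀ n → (∀ {k} → k < n → f k ≡ 0ℚ) → f n ≡ 0ℚ
    step n ih = begin
      f n           ≡⟨ *-identityʳ (f n) ⟨
      f n * 1ℚ      ≡⟨ cong (f n *_) g₀≡1 ⟨
      f n * g 0     ≡⟨ ⊛-lowest n f g (λ k → ih) ⟨
      (f ⊛ g) n     ≡⟨ fg≋0 n ⟩
      0ℚ            ∎
      where open ≡-Reasoning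

  ≋-isEquivalence : IsEquivalence _≋_
  ≋-isEquivalence = record
    { refl = λ _ → refl ; sym = λ f≋g n → sym (f≋g n) ; trans = λ f≋g g≋h n → trans (f≋g n) (g≋h n) }

  seriesCommutativeRing : CommutativeRing _ _
  seriesCommutativeRing = record { isCommutativeRing = isCommutativeRing }
    where
    isCommutativeRing : IsCommutativeRing _≋_ _⊕_ _⊛_ negS 0S series1
    isCommutativeRing = record
      { isRing = record
        { +-isAbelianGroup = record
          { isGroup = record
            { isMonoid = record
              { isSemigroup = record
                { isMagma = record
                  { isEquivalence = ≋-isEquivalence
                  ; ∙-cong = λ f≋f′ g≋g′ n → cong₂ _+_ (f≋f′ n) (g≋g′ n) }
                ; assoc = λ f g h n → +-assoc (f n) (g n) (h n) }
              ; identity = (λ f n → +-identityˡ (f n)) , (λ f n → +-identityʳ (f n)) }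
            ; inverse = (λ f n → +-inverseˡ (f n)) , (λ f n → +-inverseʳ (f n))
            ; ⁻¹-cong = λ f≋g n → cong -_ (f≋g n) }
          ; comm = λ f g n → +-comm (f n) (g n) }
        ; *-cong = ⊛-cong
        ; *-assoc = ⊛-assoc
        ; *-identity = ⊛-identityˡ , (λ f n → trans (⊛-comm f series1 n) (⊛-identityˡ f n))
        ; distrib = ⊛-distribˡ-⊕ , distribʳ }
      ; *-comm = ⊛-comm }
      where
      distribʳ : ∀ f g h → ((g ⊕ h) ⊛ f) ≋ ((g ⊛ f) ⊕ (h ⊛ f))
      distribʳ f g h n = trans (⊛-comm (g ⊕ h) f n)
        (trans (⊛-distribˡ-⊕ f g h n) (cong₂ _+_ (⊛-comm f g n) (⊛-comm f h n)))

  seriesAlmostCommutativeRing : ACR.AlmostCommutativeRing _ _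
  seriesAlmostCommutativeRing = ACR.fromCommutativeRing seriesCommutativeRing

  cst-homomorphism : ℤ.+-*-rawRing ACR.-Raw-AlmostCommutative⟶ seriesAlmostCommutativeRing
  cst-homomorphism = record
    { ⟦_⟧ = cst
    ; +-homo = λ { x y zero → fromℤ-+ x y ; x y (suc n) → refl }
    ; *-homo = λ x y n → sym (trans (const-⊛ (fromℤ x) (cst y) n) (*-homo x y n))
    ; -‿homo = λ { x zero → fromℤ-neg x ; x (suc n) → refl }
    ; 0-homo = λ { zero → refl ; (suc n) → refl }
    ; 1-homo = λ { zero → refl ; (suc n) → refl } }
    where
    *-homo : ∀ x y n → fromℤ x * cst y n ≡ cst (x ℤ.* y) n
    *-homo x y zero = sym (fromℤ-* x y)
    *-homo x y (suc n) = *-zeroʳ (fromℤ x)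

  cst-≟ : ∀ a b → Maybe (cst a ≋ cst b)
  cst-≟ a b with a ℤ.≟ b
  ... | yes refl = just (λ _ → refl)
  ... | no _ = nothing

  open import Algebra.Solver.Ring ℤ.+-*-rawRing seriesAlmostCommutativeRing cst-homomorphism cst-≟ public

  -- Identities under hypotheses are proved by writing the goal as
  -- lhs = rhs + Σ qᵢ (hᵢ − hᵢ′), checking that polynomial identity with solve,
  -- and discarding the remainder, which vanishes by the hypotheses hᵢ ≋ hᵢ′.

  ≋-by-remainder : ∀ {f g r} → f ≋ (g ⊕ r) → r ≋ 0S → f ≋ g
  ≋-by-remainder {g = g} f≋g+r r≋0 n = trans (f≋g+r n) (trans (cong (λ x → g n + x) (r≋0 n)) (+-identityʳ (g n)))

  ≋⇒difference≋0 : ∀ {f g} → f ≋ g → (f ⊕ negS g) ≋ 0S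
  ≋⇒difference≋0 {g = g} f≋g n = trans (cong (_+ - g n) (f≋g n)) (+-inverseʳ (g n))

  difference≋0⇒≋ : ∀ {f g} → (f ⊕ negS g) ≋ 0S → f ≋ g
  difference≋0⇒≋ {f} {g} =
    ≋-by-remainder {f} {g} (solve 2 (λ f g → f := g :+ (f :- g)) (λ _ → refl) f g)

  ⊕-≋0 : ∀ {f g} → f ≋ 0S → g ≋ 0S → (f ⊕ g) ≋ 0S
  ⊕-≋0 f≋0 g≋0 n = cong₂ _+_ (f≋0 n) (g≋0 n)

  ⊛-≋0 : ∀ f {g} → g ≋ 0S → (f ⊛ g) ≋ 0S
  ⊛-≋0 f g≋0 n = sumTo-zero n _ (λ k _ → trans (cong (f k *_) (g≋0 (n ∸ k))) (*-zeroʳ (f k)))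

  mono≋cst⊛t^ : ∀ z m → mono (fromℤ z) m ≋ (cst z ⊛ t^ m)
  mono≋cst⊛t^ z m n = trans (coefficient n) (sym (const-⊛ (fromℤ z) (t^ m) n))
    where
    coefficient : ∀ n → mono (fromℤ z) m n ≡ fromℤ z * (t^ m) n
    coefficient n with n ℕ.≟ m
    ... | yes _ = sym (*-identityʳ (fromℤ z))
    ... | no _ = sym (*-zeroʳ (fromℤ z))

  t^-⊛-cancel : ∀ m f → (t^ m ⊛ f) ≋ 0S → f ≋ 0S
  t^-⊛-cancel m f tᵐf≋0 n = trans (sym (*-identityˡ (f n))) (trans (sym (mono-⊛-shift 1ℚ m f n)) (tᵐf≋0 (m ℕ.+ n)))

  cst-⊛-cancel : ∀ k f → (cst (+ suc k) ⊛ f) ≋ 0S → f ≋ 0S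
  cst-⊛-cancel k f kf≋0 n = fromℕ-*-cancel k (f n) (trans (sym (const-⊛ (fromℕ (suc k)) f n)) (kf≋0 n))

  t^-+ : ∀ m n → t^ (m ℕ.+ n) ≋ (t^ m ⊛ t^ n)
  t^-+ m n = ≋-mono-⊛ 1ℚ m {t^ (m ℕ.+ n)} {t^ n} below shifted
    where
    below : ∀ k → k < m → (t^ (m ℕ.+ n)) k ≡ 0ℚ
    below k k<m = mono-other 1ℚ (m ℕ.+ n) k (λ { refl → ℕ.<-irrefl refl (ℕ.<-≤-trans k<m (ℕ.m≤m+n m n)) })
    shifted : ∀ k → (t^ (m ℕ.+ n)) (m ℕ.+ k) ≡ 1ℚ * (t^ n) k
    shifted k with k ℕ.≟ n
    ... | yes refl = mono-same 1ℚ (m ℕ.+ k)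
    ... | no k≢n = trans (mono-other 1ℚ (m ℕ.+ n) (m ℕ.+ k) (k≢n ∘ ℕ.+-cancelˡ-≡ m k n)) (sym (*-zeroʳ 1ℚ))
      where open import Function using (_∘_)

module EulerOperator where

  open import Data.Nat as ℕ using (zero; suc; _<_; _∸_)
  import Data.Nat.Properties as ℕ
  open import Data.Nat.Induction using (<-rec)
  open import Data.Integer as ℤ using (+_)
  open import Data.Rational using (0ℚ; 1ℚ; _+_; _*_; -_)
  open import Data.Rational.Properties
  open import Relation.Binary.PropositionalEquality
  open import Relation.Nullary using (yes; no)
  open import Tactic.RingSolver using (solve-∀)
  open import Defs
  open Rationals
  open FiniteSums
  open PowerSeries

  θ : Series → Series
  θ f n = fromℕ n * f n

  θ-⊛ : ∀ f g → θ (f ⊛ g) ≋ ((θ f ⊛ g) ⊕ (f ⊛ θ g))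
  θ-⊛ f g n = begin
    fromℕ n * sumTo n (λ k → f k * g (n ∸ k))
      ≡⟨ *-distribˡ-sumTo n (fromℕ n) _ ⟩
    sumTo n (λ k → fromℕ n * (f k * g (n ∸ k)))
      ≡⟨ sumTo-cong n leibniz ⟩
    sumTo n (λ k → (fromℕ k * f k) * g (n ∸ k) + f k * (fromℕ (n ∸ k) * g (n ∸ k)))
      ≡⟨ sumTo-distrib-+ n _ _ ⟩
    ((θ f ⊛ g) ⊕ (f ⊛ θ g)) n ∎
    where
    open ≡-Reasoning
    distribute : ∀ a b x y → (a + b) * (x * y) ≡ (a * x) * y + x * (b * y)
    distribute = solve-∀ ℚ-ring
    leibniz : ∀ k → k ℕ.≤ n → fromℕ n * (f k * g (n ∸ k)) ≡ (fromℕ k * f k) * g (n ∸ k) + f k * (fromℕ (n ∸ k) * g (n ∸ k))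
    leibniz k k≤n = trans (cong (_* (f k * g (n ∸ k))) (trans (cong fromℕ (sym (ℕ.m+[n∸m]≡n k≤n))) (fromℕ-+ k (n ∸ k))))
                          (distribute (fromℕ k) (fromℕ (n ∸ k)) (f k) (g (n ∸ k)))

  θ-⊕ : ∀ f g → θ (f ⊕ g) ≋ (θ f ⊕ θ g)
  θ-⊕ f g n = *-distribˡ-+ (fromℕ n) (f n) (g n)

  θ-negS : ∀ f → θ (negS f) ≋ negS (θ f)
  θ-negS f n = sym (neg-distribʳ-* (fromℕ n) (f n))

  θ-const : ∀ c → θ (const c) ≋ 0S
  θ-const c zero = *-zeroˡ c
  θ-const c (suc n) = *-zeroʳ (fromℕ (suc n))

  θ-cong : ∀ {f g} → f ≋ g → θ f ≋ θ g
  θ-cong f≋g n = cong (fromℕ n *_) (f≋g n)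

  θ-mono : ∀ c m → θ (mono c m) ≋ mono (fromℕ m * c) m
  θ-mono c m n with n ℕ.≟ m
  ... | yes refl = refl
  ... | no _ = *-zeroʳ (fromℕ n)

  θ-cst⊛t^ : ∀ z m → θ (cst z ⊛ t^ m) ≋ (cst (+ m ℤ.* z) ⊛ t^ m)
  θ-cst⊛t^ z m n = begin
    fromℕ n * (cst z ⊛ t^ m) n                ≡⟨ cong (fromℕ n *_) (mono≋cst⊛t^ z m n) ⟨
    θ (mono (fromℤ z) m) n                    ≡⟨ θ-mono (fromℤ z) m n ⟩
    mono (fromℕ m * fromℤ z) m n              ≡⟨ cong (λ c → mono c m n) (fromℤ-* (+ m) z) ⟨
    mono (fromℤ (+ m ℤ.* z)) m n              ≡⟨ mono≋cst⊛t^ (+ m ℤ.* z) m n ⟩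
    (cst (+ m ℤ.* z) ⊛ t^ m) n                ∎
    where open ≡-Reasoning

  -- As a₀ = 1 and b₀ = 0, coefficient n of the equation expresses n dₙ through d₀, …, dₙ₋₁.
  θ-equation-unique : ∀ a b d → a 0 ≡ 1ℚ → b 0 ≡ 0ℚ → d 0 ≡ 0ℚ → (a ⊛ θ d) ≋ (b ⊛ d) → d ≋ 0S
  θ-equation-unique a b d a₀≡1 b₀≡0 d₀≡0 eq = <-rec (λ k → d k ≡ 0ℚ) step
    where
    step : ∀ n → (∀ {k} → k < n → d k ≡ 0ℚ) → d n ≡ 0ℚ
    step zero _ = d₀≡0
    step (suc n) ih = fromℕ-*-cancel n (d (suc n)) (begin
      θ d (suc n)          ≡⟨ *-identityʳ (θ d (suc n)) ⟨
      θ d (suc n) * 1ℚ     ≡⟨ cong (θ d (suc n) *_) a₀≡1 ⟨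
      θ d (suc n) * a 0    ≡⟨ ⊛-lowest (suc n) (θ d) a (λ k k<n → trans (cong (fromℕ k *_) (ih k<n)) (*-zeroʳ (fromℕ k))) ⟨
      (θ d ⊛ a) (suc n)    ≡⟨ ⊛-comm (θ d) a (suc n) ⟩
      (a ⊛ θ d) (suc n)    ≡⟨ eq (suc n) ⟩
      (b ⊛ d) (suc n)      ≡⟨ ⊛-comm b d (suc n) ⟩
      (d ⊛ b) (suc n)      ≡⟨ ⊛-lowest (suc n) d b (λ k → ih) ⟩
      d (suc n) * b 0      ≡⟨ cong (d (suc n) *_) b₀≡0 ⟩
      d (suc n) * 0ℚ       ≡⟨ *-zeroʳ (d (suc n)) ⟩
      0ℚ                   ∎)
      where open ≡-Reasoning

module BinomialSeries where

  open import Data.Nat as ℕ using (ℕ; zero; suc; _≤_; z≤n; s≤s)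
  import Data.Nat.Properties as ℕ
  open import Data.Integer using (1ℤ)
  open import Data.Rational as ℚ using (ℚ; 0ℚ; 1ℚ; _+_; _*_; _-_)
  open import Data.Rational.Properties
  open import Relation.Binary.PropositionalEquality
  open import Data.Empty using (⊥-elim)
  open import Tactic.RingSolver using (solve-∀)
  open import Defs
  open Rationals
  open FiniteSums
  open PowerSeries
  open EulerOperator

  double : ℕ → ℕ
  double zero = zero
  double (suc k) = suc (suc (double k))

  data Parity : ℕ → Set where
    even : ∀ m → Parity (double m)
    odd  : ∀ m → Parity (suc (double m))

  parity : ∀ n → Parity n
  parity zero = even zero
  parity (suc n) with parity n
  ... | even m = odd m
  ... | odd m = even (suc m)

  double-injective : ∀ a b → double a ≡ double b → a ≡ b
  double-injective zero zero _ = refl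
  double-injective (suc a) (suc b) eq = cong suc (double-injective a b (ℕ.suc-injective (ℕ.suc-injective eq)))

  double≢odd : ∀ a b → double a ≢ suc (double b)
  double≢odd (suc a) zero eq = ℕ.0≢1+n (sym (ℕ.suc-injective eq))
  double≢odd (suc a) (suc b) eq = double≢odd a b (ℕ.suc-injective (ℕ.suc-injective eq))

  m≤double : ∀ m → m ≤ double m
  m≤double zero = z≤n
  m≤double (suc m) = s≤s (ℕ.m≤n⇒m≤1+n (m≤double m))

  fromℕ-double : ∀ m → fromℕ (double m) ≡ fromℕ 2 * fromℕ m
  fromℕ-double zero = refl
  fromℕ-double (suc m) = begin
    fromℕ (2 ℕ.+ double m)       ≡⟨ fromℕ-+ 2 (double m) ⟩
    fromℕ 2 + fromℕ (double m)   ≡⟨ cong (fromℕ 2 +_) (fromℕ-double m) ⟩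
    fromℕ 2 + fromℕ 2 * fromℕ m  ≡⟨ sym (trans (cong (fromℕ 2 *_) (fromℕ-+ 1 m)) (*-distribˡ-+ (fromℕ 2) 1ℚ (fromℕ m))) ⟩
    fromℕ 2 * fromℕ (suc m)      ∎
    where open ≡-Reasoning

  infixr 8 _^_
  _^_ : ℚ → ℕ → ℚ
  c ^ zero = 1ℚ
  c ^ suc k = c * c ^ k

  powS-mono-double : ∀ c k → powS (mono c 2) k (double k) ≡ c ^ k
  powS-mono-double c zero = refl
  powS-mono-double c (suc k) =
    trans (mono-⊛-shift c 2 (powS (mono c 2) k) (double k)) (cong (c *_) (powS-mono-double c k))

  powS-mono-other : ∀ c k n → n ≢ double k → powS (mono c 2) k n ≡ 0ℚ
  powS-mono-other c zero zero n≢0 = ⊥-elim (n≢0 refl)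
  powS-mono-other c zero (suc n) _ = refl
  powS-mono-other c (suc k) zero _ = mono-⊛-below c 2 (powS (mono c 2) k) 0 (s≤s z≤n)
  powS-mono-other c (suc k) (suc zero) _ = mono-⊛-below c 2 (powS (mono c 2) k) 1 (s≤s (s≤s z≤n))
  powS-mono-other c (suc k) (suc (suc n)) n≢2k = trans (mono-⊛-shift c 2 (powS (mono c 2) k) n)
    (trans (cong (c *_) (powS-mono-other c k n (n≢2k ∘ cong (λ i → suc (suc i))))) (*-zeroʳ c))
    where open import Function using (_∘_)

  binomPow-even : ∀ α c m → binomPow α (mono c 2) (double m) ≡ binom α m * c ^ m
  binomPow-even α c m =
    trans (sumTo-singleton (double m) m _ (m≤double m) off)
          (cong (binom α m *_) (powS-mono-double c m))
    where
    off : ∀ k → k ≢ m → binom α k * powS (mono c 2) k (double m) ≡ 0ℚ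
    off k k≢m = trans (cong (binom α k *_) (powS-mono-other c k (double m) (λ eq → k≢m (sym (double-injective m k eq)))))
                      (*-zeroʳ (binom α k))

  binomPow-odd : ∀ α c m → binomPow α (mono c 2) (suc (double m)) ≡ 0ℚ
  binomPow-odd α c m = sumTo-zero (suc (double m)) _ (λ k _ →
    trans (cong (binom α k *_) (powS-mono-other c k (suc (double m)) (λ eq → double≢odd k m (sym eq))))
          (*-zeroʳ (binom α k)))

  -- Coefficientwise, θ-binomPow is the recursion (m+1) binom(α, m+1) = (α − m) binom(α, m).
  module _ (α c : ℚ) where

    private
      U : Series
      U = binomPow α (mono c 2)

    θ-binomPow-even : ∀ m → θ U (double (suc m)) + c * θ U (double m) ≡ (fromℕ 2 * α * c) * U (double m)
    θ-binomPow-even m rewrite binomPow-even α c (suc m) | binomPow-even α c m | fromℕ-double (suc m) | fromℕ-double m = begin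
      fromℕ 2 * m+1 * (b * (α - m′) * m+1⁻¹ * (c * p)) + c * (fromℕ 2 * m′ * (b * p))
        ≡⟨ collect (fromℕ 2) m+1 b α m′ m+1⁻¹ c p ⟩
      fromℕ 2 * b * c * p * ((α - m′) * (m+1 * m+1⁻¹) + m′)
        ≡⟨ cong (λ x → fromℕ 2 * b * c * p * ((α - m′) * x + m′)) (fromℕ-*-inverse m) ⟩
      fromℕ 2 * b * c * p * ((α - m′) * 1ℚ + m′)
        ≡⟨ simplify (fromℕ 2) b α m′ c p ⟩
      fromℕ 2 * α * c * (b * p) ∎
      where
      open ≡-Reasoning
      m+1 = fromℕ (suc m)
      m′ = fromℕ m
      b = binom α m
      p = c ^ m
      m+1⁻¹ = 1ℤ ℚ./ suc m
      collect : ∀ t s b a M i c P → t * s * (b * (a - M) * i * (c * P)) + c * (t * M * (b * P))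
                                    ≡ t * b * c * P * ((a - M) * (s * i) + M)
      collect = solve-∀ ℚ-ring
      simplify : ∀ t b a M c P → t * b * c * P * ((a - M) * 1ℚ + M) ≡ t * a * c * (b * P)
      simplify = solve-∀ ℚ-ring

    θ-binomPow-odd : ∀ m → θ U (suc (double (suc m))) + c * θ U (suc (double m)) ≡ (fromℕ 2 * α * c) * U (suc (double m))
    θ-binomPow-odd m rewrite binomPow-odd α c (suc m) | binomPow-odd α c m =
      trans (cong₂ _+_ (*-zeroʳ (fromℕ (suc (double (suc m)))))
                       (trans (cong (c *_) (*-zeroʳ (fromℕ (suc (double m))))) (*-zeroʳ c)))
            (sym (*-zeroʳ (fromℕ 2 * α * c)))

    θ-binomPow : ((series1 ⊕ mono c 2) ⊛ θ U) ≋ (mono (fromℕ 2 * α * c) 2 ⊛ U)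
    θ-binomPow n = trans (expand n) (coefficient n)
      where
      expand : ((series1 ⊕ mono c 2) ⊛ θ U) ≋ (θ U ⊕ (mono c 2 ⊛ θ U))
      expand = solve 2 (λ f g → (con 1ℤ :+ f) :* g := g :+ f :* g) (λ _ → refl) (mono c 2) (θ U)
      coefficient : ∀ n → θ U n + (mono c 2 ⊛ θ U) n ≡ (mono (fromℕ 2 * α * c) 2 ⊛ U) n
      coefficient zero = trans (cong₂ _+_ (*-zeroˡ (U 0)) (mono-⊛-below c 2 (θ U) 0 (s≤s z≤n)))
                               (sym (mono-⊛-below (fromℕ 2 * α * c) 2 U 0 (s≤s z≤n)))
      coefficient (suc zero) = trans (cong₂ _+_ (trans (cong (fromℕ 1 *_) (binomPow-odd α c 0)) (*-zeroʳ (fromℕ 1)))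
                                                (mono-⊛-below c 2 (θ U) 1 (s≤s (s≤s z≤n))))
                                     (sym (mono-⊛-below (fromℕ 2 * α * c) 2 U 1 (s≤s (s≤s z≤n))))
      coefficient (suc (suc n)) with parity n
      ... | even m = trans (cong (θ U (double (suc m)) +_) (mono-⊛-shift c 2 (θ U) (double m)))
                           (trans (θ-binomPow-even m) (sym (mono-⊛-shift (fromℕ 2 * α * c) 2 U (double m))))
      ... | odd m = trans (cong (θ U (suc (double (suc m))) +_) (mono-⊛-shift c 2 (θ U) (suc (double m))))
                          (trans (θ-binomPow-odd m) (sym (mono-⊛-shift (fromℕ 2 * α * c) 2 U (suc (double m)))))

module SquareRoot where

  open import Data.Nat as ℕ using (zero; suc; s≤s)
  open import Data.Integer as ℤ using (+_)
  open import Data.Rational as ℚ using (ℚ; 0ℚ; 1ℚ; _+_; _*_; -_)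
  open import Data.Rational.Properties
  open import Relation.Binary.PropositionalEquality
  open import Defs
  open PowerSeries
  open EulerOperator
  open BinomialSeries

  1-8t² : Series
  1-8t² = series1 ⊕ (cst (ℤ.- (+ 8)) ⊛ t²)

  θ-1-8t² : θ 1-8t² ≋ (cst (ℤ.- (+ 16)) ⊛ t²)
  θ-1-8t² n = trans (θ-⊕ series1 (cst (ℤ.- (+ 8)) ⊛ t²) n)
                    (trans (cong₂ _+_ (θ-const 1ℚ n) (θ-cst⊛t^ (ℤ.- (+ 8)) 2 n)) (+-identityˡ _))

  c₋₈ : ℚ
  c₋₈ = fromℤ (ℤ.- (+ 8))

  series1⊕mono≋1-8t² : (series1 ⊕ mono c₋₈ 2) ≋ 1-8t²
  series1⊕mono≋1-8t² n = cong (λ x → series1 n + x) (mono≋cst⊛t^ (ℤ.- (+ 8)) 2 n)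

  θ-binomPow-1-8t² : ∀ α z → fromℕ 2 * α * c₋₈ ≡ fromℤ z →
                     (1-8t² ⊛ θ (binomPow α (mono c₋₈ 2))) ≋ ((cst z ⊛ t²) ⊛ binomPow α (mono c₋₈ 2))
  θ-binomPow-1-8t² α z 2αc≡z n = begin
    (1-8t² ⊛ θ U) n                              ≡⟨ ⊛-cong {g = θ U} {θ U} series1⊕mono≋1-8t² (λ _ → refl) n ⟨
    ((series1 ⊕ mono c₋₈ 2) ⊛ θ U) n             ≡⟨ θ-binomPow α c₋₈ n ⟩
    (mono (fromℕ 2 * α * c₋₈) 2 ⊛ U) n           ≡⟨ ⊛-cong {mono (fromℕ 2 * α * c₋₈) 2} {cst z ⊛ t²} {U} {U} (λ k → trans (cong (λ c → mono c 2 k) 2αc≡z) (mono≋cst⊛t^ z 2 k)) (λ _ → refl) n ⟩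
    ((cst z ⊛ t²) ⊛ U) n                         ∎
    where
    open ≡-Reasoning
    U = binomPow α (mono c₋₈ 2)

  θ-sqrt18 : (1-8t² ⊛ θ sqrt18) ≋ ((cst (ℤ.- (+ 8)) ⊛ t²) ⊛ sqrt18)
  θ-sqrt18 = θ-binomPow-1-8t² ((+ 1) ℚ./ 2) (ℤ.- (+ 8)) refl

  θ-pow32-18 : (1-8t² ⊛ θ pow32-18) ≋ ((cst (ℤ.- (+ 24)) ⊛ t²) ⊛ pow32-18)
  θ-pow32-18 = θ-binomPow-1-8t² ((+ 3) ℚ./ 2) (ℤ.- (+ 24)) refl

  sqrt18-squared : (sqrt18 ⊛ sqrt18) ≋ 1-8t²
  sqrt18-squared = difference≋0⇒≋ (θ-equation-unique 1-8t² b D refl refl refl θD-equation)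
    where
    S = sqrt18
    b = cst (ℤ.- (+ 16)) ⊛ t²
    D = (S ⊛ S) ⊕ negS 1-8t²
    θD = ((θ S ⊛ S) ⊕ (S ⊛ θ S)) ⊕ negS b
    θD≋ : θ D ≋ θD
    θD≋ n = trans (θ-⊕ (S ⊛ S) (negS 1-8t²) n)
                  (cong₂ _+_ (θ-⊛ S S n) (trans (θ-negS 1-8t² n) (cong -_ (θ-1-8t² n))))
    hS = (1-8t² ⊛ θ S) ⊕ negS ((cst (ℤ.- (+ 8)) ⊛ t²) ⊛ S)
    identity : (1-8t² ⊛ θD) ≋ ((b ⊛ D) ⊕ ((cst (+ 2) ⊛ S) ⊛ hS))
    identity = solve 3 (λ s θs x →
        (con (+ 1) :+ con (ℤ.- (+ 8)) :* x) :* (((θs :* s) :+ (s :* θs)) :- con (ℤ.- (+ 16)) :* x)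
        := (con (ℤ.- (+ 16)) :* x) :* ((s :* s) :- (con (+ 1) :+ con (ℤ.- (+ 8)) :* x))
           :+ (con (+ 2) :* s) :* ((con (+ 1) :+ con (ℤ.- (+ 8)) :* x) :* θs :- (con (ℤ.- (+ 8)) :* x) :* s))
      (λ _ → refl) S (θ S) t²
    θD-equation : (1-8t² ⊛ θ D) ≋ (b ⊛ D)
    θD-equation = ≋-by-remainder {1-8t² ⊛ θ D} {b ⊛ D}
      (λ n → trans (⊛-cong {1-8t²} {1-8t²} {θ D} {θD} (λ _ → refl) θD≋ n) (identity n))
      (⊛-≋0 (cst (+ 2) ⊛ S) (≋⇒difference≋0 θ-sqrt18))

  pow32-18≋1-8t²⊛sqrt18 : pow32-18 ≋ (1-8t² ⊛ sqrt18)
  pow32-18≋1-8t²⊛sqrt18 = difference≋0⇒≋ (θ-equation-unique 1-8t² b D refl refl refl θD-equation)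
    where
    S = sqrt18
    V = pow32-18
    b = cst (ℤ.- (+ 24)) ⊛ t²
    D = V ⊕ negS (1-8t² ⊛ S)
    θD = θ V ⊕ negS (((cst (ℤ.- (+ 16)) ⊛ t²) ⊛ S) ⊕ (1-8t² ⊛ θ S))
    θD≋ : θ D ≋ θD
    θD≋ n = trans (θ-⊕ V (negS (1-8t² ⊛ S)) n)
      (cong (λ x → θ V n + x) (trans (θ-negS (1-8t² ⊛ S) n) (cong -_ (trans (θ-⊛ 1-8t² S n)
        (cong (λ x → x + (1-8t² ⊛ θ S) n) (⊛-cong {θ 1-8t²} {cst (ℤ.- (+ 16)) ⊛ t²} {S} {S} θ-1-8t² (λ _ → refl) n))))))
    hS = (1-8t² ⊛ θ S) ⊕ negS ((cst (ℤ.- (+ 8)) ⊛ t²) ⊛ S)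
    hV = (1-8t² ⊛ θ V) ⊕ negS (b ⊛ V)
    identity : (1-8t² ⊛ θD) ≋ ((b ⊛ D) ⊕ (hV ⊕ negS (1-8t² ⊛ hS)))
    identity = solve 5 (λ v θv s θs x →
        let a = con (+ 1) :+ con (ℤ.- (+ 8)) :* x in
        a :* (θv :- ((con (ℤ.- (+ 16)) :* x) :* s :+ a :* θs))
        := (con (ℤ.- (+ 24)) :* x) :* (v :- a :* s)
           :+ ((a :* θv :- (con (ℤ.- (+ 24)) :* x) :* v) :- a :* (a :* θs :- (con (ℤ.- (+ 8)) :* x) :* s)))
      (λ _ → refl) V (θ V) S (θ S) t²
    θD-equation : (1-8t² ⊛ θ D) ≋ (b ⊛ D)
    θD-equation = ≋-by-remainder {1-8t² ⊛ θ D} {b ⊛ D}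
      (λ n → trans (⊛-cong {1-8t²} {1-8t²} {θ D} {θD} (λ _ → refl) θD≋ n) (identity n))
      (⊕-≋0 (≋⇒difference≋0 θ-pow32-18) (λ n → cong -_ (⊛-≋0 1-8t² (≋⇒difference≋0 θ-sqrt18) n)))

  -- catalan = (1 − (1 − 8t²)^{1/2}) / 4t² = Σ 2ⁿ Catalan(n) t²ⁿ.
  catalan : Series
  catalan n = (ℤ.- (+ 1)) ℚ./ 4 * sqrt18 (suc (suc n))

  sqrt18≋1-4t²catalan : sqrt18 ≋ (series1 ⊕ (cst (ℤ.- (+ 4)) ⊛ (t² ⊛ catalan)))
  sqrt18≋1-4t²catalan = ≋-by-remainder {sqrt18} {series1 ⊕ (cst (ℤ.- (+ 4)) ⊛ (t² ⊛ catalan))}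
    (solve 3 (λ s m x → s := (con (+ 1) :+ x) :+ (((s :- con (+ 1)) :- m) :+ (m :- x))) (λ _ → refl)
       sqrt18 (mono (fromℤ (ℤ.- (+ 4))) 2 ⊛ catalan) (cst (ℤ.- (+ 4)) ⊛ (t² ⊛ catalan)))
    (⊕-≋0 (≋⇒difference≋0 (≋-mono-⊛ (fromℤ (ℤ.- (+ 4))) 2 {sqrt18 ⊕ negS series1} {catalan} below shifted))
          (≋⇒difference≋0 (λ n → trans (⊛-cong {mono (fromℤ (ℤ.- (+ 4))) 2} {cst (ℤ.- (+ 4)) ⊛ t²} {catalan} {catalan}
                                                (mono≋cst⊛t^ (ℤ.- (+ 4)) 2) (λ _ → refl) n)
                                       (⊛-assoc (cst (ℤ.- (+ 4))) t² catalan n))))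
    where
    below : ∀ n → n ℕ.< 2 → (sqrt18 ⊕ negS series1) n ≡ 0ℚ
    below zero _ = refl
    below (suc zero) _ = refl
    below (suc (suc n)) (s≤s (s≤s ()))
    shifted : ∀ n → (sqrt18 ⊕ negS series1) (2 ℕ.+ n) ≡ fromℤ (ℤ.- (+ 4)) * catalan n
    shifted n = sym (begin
      fromℤ (ℤ.- (+ 4)) * (-¼ * s)   ≡⟨ *-assoc (fromℤ (ℤ.- (+ 4))) -¼ s ⟨
      (fromℤ (ℤ.- (+ 4)) * -¼) * s   ≡⟨ *-identityˡ s ⟩
      s                              ≡⟨ +-identityʳ s ⟨
      s + - 0ℚ                       ∎)
      where
      open ≡-Reasoning
      s = sqrt18 (2 ℕ.+ n)
      -¼ = (ℤ.- (+ 1)) ℚ./ 4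

  catalan-equation : catalan ≋ (series1 ⊕ (cst (+ 2) ⊛ (t² ⊛ (catalan ⊛ catalan))))
  catalan-equation = difference≋0⇒≋ (cst-⊛-cancel 7 F (t^-⊛-cancel 2 (cst (+ 8) ⊛ F) (λ n → trans (identity n) (remainder≋0 n))))
    where
    S = sqrt18
    C = catalan
    F = C ⊕ negS (series1 ⊕ (cst (+ 2) ⊛ (t² ⊛ (C ⊛ C))))
    B = series1 ⊕ (cst (ℤ.- (+ 4)) ⊛ (t² ⊛ C))
    remainder = ((S ⊕ negS B) ⊛ (S ⊕ B)) ⊕ negS ((S ⊛ S) ⊕ negS 1-8t²)
    identity : (t² ⊛ (cst (+ 8) ⊛ F)) ≋ remainder
    identity = solve 3 (λ s c x →
        x :* (con (+ 8) :* (c :- (con (+ 1) :+ con (+ 2) :* (x :* (c :* c)))))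
        := (s :- (con (+ 1) :+ con (ℤ.- (+ 4)) :* (x :* c))) :* (s :+ (con (+ 1) :+ con (ℤ.- (+ 4)) :* (x :* c)))
           :- ((s :* s) :- (con (+ 1) :+ con (ℤ.- (+ 8)) :* x)))
      (λ _ → refl) S C t²
    remainder≋0 : remainder ≋ 0S
    remainder≋0 = ⊕-≋0 (λ n → trans (⊛-comm (S ⊕ negS B) (S ⊕ B) n) (⊛-≋0 (S ⊕ B) (≋⇒difference≋0 sqrt18≋1-4t²catalan) n))
                       (λ n → cong -_ (≋⇒difference≋0 sqrt18-squared n))

module Exponential where

  open import Data.Nat as ℕ using (ℕ; zero; suc; _≤_; _<_; s≤s; _∸_)
  import Data.Nat.Properties as ℕ
  open import Data.Integer using (1ℤ)
  open import Data.Rational as ℚ using (0ℚ; 1ℚ; _+_; _*_)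
  open import Data.Rational.Properties
  open import Relation.Binary.PropositionalEquality
  open import Tactic.RingSolver using (solve-∀)
  open import Defs
  open Rationals
  open FiniteSums
  open PowerSeries
  open EulerOperator

  module _ (f : Series) (f₀≡0 : f 0 ≡ 0ℚ) where

    powS-vanishes : ∀ k n → n < k → powS f k n ≡ 0ℚ
    powS-vanishes (suc k) n (s≤s n≤k) = sumTo-zero n _ term
      where
      term : ∀ i → i ≤ n → f i * powS f k (n ∸ i) ≡ 0ℚ
      term zero _ = trans (cong (_* powS f k n) f₀≡0) (*-zeroˡ (powS f k n))
      term (suc i) i<n = trans (cong (f (suc i) *_) (powS-vanishes k (n ∸ suc i) (ℕ.<-≤-trans (n∸1+i<n i<n) n≤k)))
                               (*-zeroʳ (f (suc i)))
        where
        n∸1+i<n : ∀ {n i} → suc i ≤ n → n ∸ suc i < n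
        n∸1+i<n {suc n} {i} (s≤s i≤n) = s≤s (ℕ.m∸n≤m n i)

    θ-powS : ∀ k → θ (powS f (suc k)) ≋ (const (fromℕ (suc k)) ⊛ (θ f ⊛ powS f k))
    θ-powS zero n = begin
      θ (f ⊛ powS f 0) n                               ≡⟨ θ-⊛ f (powS f 0) n ⟩
      (θ f ⊛ powS f 0) n + (f ⊛ θ (powS f 0)) n        ≡⟨ cong ((θ f ⊛ powS f 0) n +_) (⊛-≋0 f θ-powS-zero n) ⟩
      (θ f ⊛ powS f 0) n + 0ℚ                          ≡⟨ +-identityʳ _ ⟩
      (θ f ⊛ powS f 0) n                               ≡⟨ ⊛-identityˡ (θ f ⊛ powS f 0) n ⟨
      (const (fromℕ 1) ⊛ (θ f ⊛ powS f 0)) n           ∎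
      where
      open ≡-Reasoning
      θ-powS-zero : θ (powS f 0) ≋ 0S
      θ-powS-zero zero = refl
      θ-powS-zero (suc n) = *-zeroʳ (fromℕ (suc n))
    θ-powS (suc k) n = begin
      θ (f ⊛ P) n
        ≡⟨ θ-⊛ f P n ⟩
      (θ f ⊛ P) n + (f ⊛ θ P) n
        ≡⟨ cong ((θ f ⊛ P) n +_) (⊛-cong {f} {f} (λ _ → refl) (θ-powS k) n) ⟩
      (θ f ⊛ P) n + (f ⊛ (const (fromℕ (suc k)) ⊛ (θ f ⊛ powS f k))) n
        ≡⟨ solve 4 (λ θf f p k+1 → θf :* (f :* p) :+ f :* (k+1 :* (θf :* p)) := (con 1ℤ :+ k+1) :* (θf :* (f :* p)))
                 (λ _ → refl) (θ f) f (powS f k) (const (fromℕ (suc k))) n ⟩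
      ((cst 1ℤ ⊕ const (fromℕ (suc k))) ⊛ (θ f ⊛ P)) n
        ≡⟨ ⊛-cong {cst 1ℤ ⊕ const (fromℕ (suc k))} {const (fromℕ (suc (suc k)))} {θ f ⊛ P} {θ f ⊛ P}
                  (λ { zero → sym (fromℕ-+ 1 (suc k)) ; (suc _) → refl }) (λ _ → refl) n ⟩
      (const (fromℕ (suc (suc k))) ⊛ (θ f ⊛ P)) n ∎
      where
      open ≡-Reasoning
      P = powS f (suc k)

    private
      c = invFact
      Σ-θf⊛powS : ℕ → Series
      Σ-θf⊛powS m n = sumTo m (λ j → c j * (θ f ⊛ powS f j) n)
      swap : ∀ a b x → a * (b * x) ≡ b * (a * x)
      swap = solve-∀ ℚ-ring

    θ-expS-suc : ∀ m → θ (expS f) (suc m) ≡ Σ-θf⊛powS m (suc m)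
    θ-expS-suc m = begin
      fromℕ n * sumTo n (λ k → c k * powS f k n)
        ≡⟨ *-distribˡ-sumTo n (fromℕ n) _ ⟩
      sumTo n (λ k → fromℕ n * (c k * powS f k n))
        ≡⟨ sumTo-cong n (λ k _ → swap (fromℕ n) (c k) (powS f k n)) ⟩
      sumTo n (λ k → c k * θ (powS f k) n)
        ≡⟨ sumTo-suc m _ ⟩
      c 0 * θ (powS f 0) n + sumTo m (λ j → c (suc j) * θ (powS f (suc j)) n)
        ≡⟨ cong₂ _+_ (trans (cong (c 0 *_) (*-zeroʳ (fromℕ n))) (*-zeroʳ (c 0))) (sumTo-cong m (λ j _ → lower j)) ⟩
      0ℚ + Σ-θf⊛powS m n
        ≡⟨ +-identityˡ _ ⟩
      Σ-θf⊛powS m n ∎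
      where
      open ≡-Reasoning
      n = suc m
      lower : ∀ j → c (suc j) * θ (powS f (suc j)) n ≡ c j * (θ f ⊛ powS f j) n
      lower j = begin
        c (suc j) * θ (powS f (suc j)) n                   ≡⟨ cong (c (suc j) *_) (θ-powS j n) ⟩
        c (suc j) * (const (fromℕ (suc j)) ⊛ X) n          ≡⟨ cong (c (suc j) *_) (const-⊛ (fromℕ (suc j)) X n) ⟩
        (c j * j+1⁻¹) * (fromℕ (suc j) * X n)              ≡⟨ regroup (c j) j+1⁻¹ (fromℕ (suc j)) (X n) ⟩
        c j * ((fromℕ (suc j) * j+1⁻¹) * X n)              ≡⟨ cong (λ z → c j * (z * X n)) (fromℕ-*-inverse j) ⟩
        c j * (1ℚ * X n)                                   ≡⟨ cong (c j *_) (*-identityˡ (X n)) ⟩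
        c j * X n                                          ∎
        where
        X = θ f ⊛ powS f j
        j+1⁻¹ = 1ℤ ℚ./ suc j
        regroup : ∀ a i s x → (a * i) * (s * x) ≡ a * ((s * i) * x)
        regroup = solve-∀ ℚ-ring

    θf⊛expS-suc : ∀ m → (θ f ⊛ expS f) (suc m) ≡ Σ-θf⊛powS m (suc m)
    θf⊛expS-suc m = begin
      sumTo n (λ i → θ f i * sumTo (n ∸ i) (λ j → c j * powS f j (n ∸ i)))
        ≡⟨ sumTo-cong n (λ i _ → cong (θ f i *_) (sym (sumTo-pad (n ∸ i) n _ (ℕ.m∸n≤m n i) (high-terms i)))) ⟩
      sumTo n (λ i → θ f i * sumTo n (λ j → c j * powS f j (n ∸ i)))
        ≡⟨ sumTo-cong n (λ i _ → *-distribˡ-sumTo n (θ f i) _) ⟩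
      sumTo n (λ i → sumTo n (λ j → θ f i * (c j * powS f j (n ∸ i))))
        ≡⟨ sumTo-swap n n _ ⟩
      sumTo n (λ j → sumTo n (λ i → θ f i * (c j * powS f j (n ∸ i))))
        ≡⟨ sumTo-cong n (λ j _ → trans (sumTo-cong n (λ i _ → swap (θ f i) (c j) (powS f j (n ∸ i))))
                                       (sym (*-distribˡ-sumTo n (c j) _))) ⟩
      Σ-θf⊛powS n n
        ≡⟨ cong (Σ-θf⊛powS m n +_) (trans (cong (c n *_) top-term) (*-zeroʳ (c n))) ⟩
      Σ-θf⊛powS m n + 0ℚ
        ≡⟨ +-identityʳ _ ⟩
      Σ-θf⊛powS m n ∎
      where
      open ≡-Reasoning
      n = suc m
      high-terms : ∀ i j → n ∸ i < j → c j * powS f j (n ∸ i) ≡ 0ℚ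
      high-terms i j n-i<j = trans (cong (c j *_) (powS-vanishes j (n ∸ i) n-i<j)) (*-zeroʳ (c j))
      top-term : (θ f ⊛ powS f n) n ≡ 0ℚ
      top-term = sumTo-zero n _ term
        where
        term : ∀ i → i ≤ n → θ f i * powS f n (n ∸ i) ≡ 0ℚ
        term zero _ = trans (cong (_* powS f n n) (*-zeroˡ (f 0))) (*-zeroˡ (powS f n n))
        term (suc i) (s≤s i≤m) = trans (cong (θ f (suc i) *_) (powS-vanishes n (m ∸ i) (s≤s (ℕ.m∸n≤m m i))))
                                       (*-zeroʳ (θ f (suc i)))

    θ-expS : θ (expS f) ≋ (θ f ⊛ expS f)
    θ-expS zero = trans (*-zeroˡ (expS f 0)) (sym (trans (cong (_* expS f 0) (*-zeroˡ (f 0))) (*-zeroˡ (expS f 0))))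
    θ-expS (suc m) = trans (θ-expS-suc m) (sym (θf⊛expS-suc m))

module FreeReduction where

  open import Data.Bool using (Bool; true; false; not; _∧_)
  open import Data.Bool.Properties using (not-¬) renaming (_≟_ to _≟ᵇ_)
  open import Data.Fin.Properties using () renaming (_≟_ to _≟ᶠ_)
  open import Data.Product using (_,_)
  import Data.Product.Properties as Product
  open import Data.List using ([]; _∷_)
  import Data.List.Properties as List
  open import Data.Empty using (⊥-elim)
  open import Relation.Nullary using (Dec; yes; no)
  open import Relation.Nullary.Decidable using (⌊_⌋)
  open import Relation.Binary.PropositionalEquality
  open import Defs

  _≟ˡ_ : (x y : Letter) → Dec (x ≡ y)
  _≟ˡ_ = Product.≡-dec _≟ᶠ_ _≟ᵇ_

  _≟ʷ_ : (u v : Word) → Dec (u ≡ v)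
  _≟ʷ_ = List.≡-dec _≟ˡ_

  _⁻¹ : Letter → Letter
  (g , s) ⁻¹ = (g , not s)

  ⁻¹-involutive : ∀ x → (x ⁻¹) ⁻¹ ≡ x
  ⁻¹-involutive (g , true) = refl
  ⁻¹-involutive (g , false) = refl

  inverseLetters-⁻¹ : ∀ x → inverseLetters x (x ⁻¹) ≡ true
  inverseLetters-⁻¹ (g , s) with g ≟ᶠ g | s ≟ᵇ not s
  ... | no g≢g | _ = ⊥-elim (g≢g refl)
  ... | yes _ | yes s≡¬s = ⊥-elim (not-¬ refl s≡¬s)
  ... | yes _ | no _ = refl

  inverseLetters-⁻¹ˡ : ∀ x → inverseLetters (x ⁻¹) x ≡ true
  inverseLetters-⁻¹ˡ x = subst (λ y → inverseLetters (x ⁻¹) y ≡ true) (⁻¹-involutive x) (inverseLetters-⁻¹ (x ⁻¹))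

  inverseLetters⇒≡⁻¹ : ∀ x y → inverseLetters x y ≡ true → y ≡ x ⁻¹
  inverseLetters⇒≡⁻¹ (g , s) (h , t) eq with g ≟ᶠ h | s ≟ᵇ t
  inverseLetters⇒≡⁻¹ (g , s) (.g , t) eq | yes refl | no s≢t = cong (g ,_) (flip s t s≢t)
    where
    flip : ∀ s t → s ≢ t → t ≡ not s
    flip true true s≢t = ⊥-elim (s≢t refl)
    flip true false _ = refl
    flip false true _ = refl
    flip false false s≢t = ⊥-elim (s≢t refl)
  inverseLetters⇒≡⁻¹ _ _ () | yes _ | yes _
  inverseLetters⇒≡⁻¹ _ _ () | no _ | _

  reduced : Word → Bool
  reduced [] = true
  reduced (x ∷ []) = true
  reduced (x ∷ y ∷ u) = not (inverseLetters x y) ∧ reduced (y ∷ u)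

  reduced-tail : ∀ x u → reduced (x ∷ u) ≡ true → reduced u ≡ true
  reduced-tail x [] _ = refl
  reduced-tail x (y ∷ u) r with inverseLetters x y
  ... | false = r

  reduced-head : ∀ x y u → reduced (x ∷ y ∷ u) ≡ true → inverseLetters x y ≡ false
  reduced-head x y u r with inverseLetters x y
  ... | false = refl
  reduced-head x y u () | true

  pushLetter-reduced : ∀ x v → reduced v ≡ true → reduced (pushLetter x v) ≡ true
  pushLetter-reduced x [] _ = refl
  pushLetter-reduced x (y ∷ v) r with inverseLetters x y in eq
  ... | true = reduced-tail y v r
  ... | false = trans (cong (λ b → not b ∧ reduced (y ∷ v)) eq) r

  reduce-reduced : ∀ w → reduced (reduce w) ≡ true
  reduce-reduced [] = refl
  reduce-reduced (x ∷ w) = pushLetter-reduced x (reduce w) (reduce-reduced w)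

  -- unpush x u is the reduced form of x⁻¹u, the unique reduced v with pushLetter x v ≡ u.
  unpush : Letter → Word → Word
  unpush x [] = x ⁻¹ ∷ []
  unpush x (y ∷ u) with x ≟ˡ y
  ... | yes _ = u
  ... | no _ = x ⁻¹ ∷ y ∷ u

  unpush-reduced : ∀ x u → reduced u ≡ true → reduced (unpush x u) ≡ true
  unpush-reduced x [] _ = refl
  unpush-reduced x (y ∷ u) r with x ≟ˡ y
  ... | yes _ = reduced-tail y u r
  ... | no x≢y with inverseLetters (x ⁻¹) y in eq
  ...   | true = ⊥-elim (x≢y (sym (trans (inverseLetters⇒≡⁻¹ (x ⁻¹) y eq) (⁻¹-involutive x))))
  ...   | false = r

  pushLetter⇒unpush : ∀ x u v → reduced v ≡ true → pushLetter x v ≡ u → v ≡ unpush x u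
  pushLetter⇒unpush x u [] _ refl with x ≟ˡ x
  ... | yes _ = refl
  ... | no x≢x = ⊥-elim (x≢x refl)
  pushLetter⇒unpush x u (y ∷ v) r _ with inverseLetters x y in eq
  pushLetter⇒unpush x u (y ∷ v) r refl | true = cancelled v r
    where
    y≡x⁻¹ : y ≡ x ⁻¹
    y≡x⁻¹ = inverseLetters⇒≡⁻¹ x y eq
    y-inverse-x : inverseLetters y x ≡ true
    y-inverse-x = subst (λ y → inverseLetters y x ≡ true) (sym y≡x⁻¹) (inverseLetters-⁻¹ˡ x)
    cancelled : ∀ v → reduced (y ∷ v) ≡ true → y ∷ v ≡ unpush x v
    cancelled [] _ = cong (_∷ []) y≡x⁻¹
    cancelled (z ∷ v) r with x ≟ˡ z
    ... | no _ = cong (λ y → y ∷ z ∷ v) y≡x⁻¹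
    ... | yes refl with trans (sym y-inverse-x) (reduced-head y x v r)
    ...   | ()
  pushLetter⇒unpush x u (y ∷ v) r refl | false with x ≟ˡ x
  ... | yes _ = refl
  ... | no x≢x = ⊥-elim (x≢x refl)

  unpush⇒pushLetter : ∀ x u v → reduced u ≡ true → v ≡ unpush x u → pushLetter x v ≡ u
  unpush⇒pushLetter x [] v _ refl rewrite inverseLetters-⁻¹ x = refl
  unpush⇒pushLetter x (y ∷ u) v r eq with x ≟ˡ y
  unpush⇒pushLetter x (.x ∷ []) v r refl | yes refl = refl
  unpush⇒pushLetter x (.x ∷ z ∷ u) v r refl | yes refl rewrite reduced-head x z u r = refl
  unpush⇒pushLetter x (y ∷ u) v r refl | no _ rewrite inverseLetters-⁻¹ x = refl

  pushLetter≟⇔≟unpush : ∀ x u v → reduced u ≡ true → reduced v ≡ true →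
                        ⌊ pushLetter x v ≟ʷ u ⌋ ≡ ⌊ v ≟ʷ unpush x u ⌋
  pushLetter≟⇔≟unpush x u v ru rv with pushLetter x v ≟ʷ u | v ≟ʷ unpush x u
  ... | yes _ | yes _ = refl
  ... | no _ | no _ = refl
  ... | yes p | no ¬q = ⊥-elim (¬q (pushLetter⇒unpush x u v rv p))
  ... | no ¬p | yes q = ⊥-elim (¬p (unpush⇒pushLetter x u v ru q))

module TreeWalks where

  open import Data.Nat using (ℕ; zero; suc)
  open import Data.Integer as ℤ using (ℤ; +_)
  import Data.Integer.Properties as ℤ
  open import Data.Fin using (Fin; zero; suc)
  open import Data.Fin.Properties using () renaming (_≟_ to _≟ᶠ_)
  open import Data.Bool using (Bool; true; false; _∧_; if_then_else_)
  open import Data.Product using (_,_)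
  open import Data.List using ([]; _∷_; _++_; length; concatMap)
  open import Relation.Nullary.Decidable using (⌊_⌋)
  open import Relation.Binary.PropositionalEquality
  open import Defs
  open FreeReduction

  guard : Bool → ℤ → ℤ
  guard b z = if b then z else + 0

  guard-0 : ∀ b → guard b (+ 0) ≡ + 0
  guard-0 true = refl
  guard-0 false = refl

  guard-+-+ : ∀ b x y z → (guard b x ℤ.+ guard b y) ℤ.+ guard b z ≡ guard b ((x ℤ.+ y) ℤ.+ z)
  guard-+-+ true _ _ _ = refl
  guard-+-+ false _ _ _ = refl

  guard-+-+-swap₁₂ : ∀ b p q → (guard b q ℤ.+ guard b p) ℤ.+ guard b q ≡ guard b ((p ℤ.+ q) ℤ.+ q)
  guard-+-+-swap₁₂ b p q = trans (guard-+-+ b q p q) (cong (λ z → guard b (z ℤ.+ q)) (ℤ.+-comm q p))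

  guard-+-+-swap₁₃ : ∀ b p q → (guard b q ℤ.+ guard b q) ℤ.+ guard b p ≡ guard b ((p ℤ.+ q) ℤ.+ q)
  guard-+-+-swap₁₃ b p q =
    trans (guard-+-+ b q q p) (cong (guard b) (trans (ℤ.+-comm (q ℤ.+ q) p) (sym (ℤ.+-assoc p q q))))

  coeff : Word → ZF → ℤ
  coeff u [] = + 0
  coeff u ((c , w) ∷ x) = guard ⌊ reduce w ≟ʷ u ⌋ c ℤ.+ coeff u x

  coeffId≡coeff[] : ∀ x → coeffId x ≡ coeff [] x
  coeffId≡coeff[] [] = refl
  coeffId≡coeff[] ((c , w) ∷ x) = cong₂ ℤ._+_ (identity-term w) (coeffId≡coeff[] x)
    where
    identity-term : ∀ w → (if isIdentity w then c else + 0) ≡ guard ⌊ reduce w ≟ʷ [] ⌋ c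
    identity-term w with reduce w
    ... | [] = refl
    ... | _ ∷ _ = refl

  coeff-++ : ∀ u x y → coeff u (x ++ y) ≡ coeff u x ℤ.+ coeff u y
  coeff-++ u [] y = sym (ℤ.+-identityˡ (coeff u y))
  coeff-++ u ((c , w) ∷ x) y =
    trans (cong (λ z → guard ⌊ reduce w ≟ʷ u ⌋ c ℤ.+ z) (coeff-++ u x y))
          (sym (ℤ.+-assoc (guard ⌊ reduce w ≟ʷ u ⌋ c) (coeff u x) (coeff u y)))

  coeff-*F-++ : ∀ u x y z → coeff u ((x ++ y) *F z) ≡ coeff u (x *F z) ℤ.+ coeff u (y *F z)
  coeff-*F-++ u x y z = coeff-concatMap (λ { (c , v) → concatMap (λ { (c′ , w) → (c ℤ.* c′ , v ++ w) ∷ [] }) z }) x y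
    where
    coeff-concatMap : ∀ F x y → coeff u (concatMap F (x ++ y)) ≡ coeff u (concatMap F x) ℤ.+ coeff u (concatMap F y)
    coeff-concatMap F [] y = sym (ℤ.+-identityˡ _)
    coeff-concatMap F (e ∷ x) y = begin
      coeff u (F e ++ concatMap F (x ++ y))
        ≡⟨ coeff-++ u (F e) _ ⟩
      coeff u (F e) ℤ.+ coeff u (concatMap F (x ++ y))
        ≡⟨ cong (λ z → coeff u (F e) ℤ.+ z) (coeff-concatMap F x y) ⟩
      coeff u (F e) ℤ.+ (coeff u (concatMap F x) ℤ.+ coeff u (concatMap F y))
        ≡⟨ ℤ.+-assoc (coeff u (F e)) _ _ ⟨
      (coeff u (F e) ℤ.+ coeff u (concatMap F x)) ℤ.+ coeff u (concatMap F y)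
        ≡⟨ cong (ℤ._+ coeff u (concatMap F y)) (coeff-++ u (F e) _) ⟨
      coeff u (F e ++ concatMap F x) ℤ.+ coeff u (concatMap F y) ∎
      where open ≡-Reasoning

  letter : Letter → ZF
  letter x = (+ 1 , x ∷ []) ∷ []

  coeff-letter-*F : ∀ x u y → reduced u ≡ true → coeff u (letter x *F y) ≡ coeff (unpush x u) y
  coeff-letter-*F x u [] _ = refl
  coeff-letter-*F x u ((c , w) ∷ y) r
    rewrite pushLetter≟⇔≟unpush x u (reduce w) r (reduce-reduced w) | ℤ.*-identityˡ c =
    cong (λ z → guard ⌊ reduce w ≟ʷ unpush x u ⌋ c ℤ.+ z) (coeff-letter-*F x u y r)

  -- M is the adjacency matrix of the graph on {0, 1} with loops a^±1 at 0, d^±1 at 1,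
  -- an edge b : 0 → 1 and its reverse b⁻¹ : 1 → 0.
  source target : Letter → Fin 2
  source (zero , _) = zero
  source (suc zero , true) = zero
  source (suc zero , false) = suc zero
  source (suc (suc zero) , _) = suc zero
  target (zero , _) = zero
  target (suc zero , true) = suc zero
  target (suc zero , false) = zero
  target (suc (suc zero) , _) = suc zero

  isPath : Fin 2 → Fin 2 → Word → Bool
  isPath i j [] = ⌊ i ≟ᶠ j ⌋
  isPath i j (x ∷ u) = ⌊ source x ≟ᶠ i ⌋ ∧ isPath (target x) j u

  -- Every vertex has three outgoing letters, so reduced paths form a 3-regular tree;
  -- treeWalks n k counts the n-step walks between two vertices at distance k in it.
  treeWalks : ℕ → ℕ → ℤ
  treeWalks zero zero = + 1
  treeWalks zero (suc k) = + 0
  treeWalks (suc n) zero = (treeWalks n 1 ℤ.+ treeWalks n 1) ℤ.+ treeWalks n 1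
  treeWalks (suc n) (suc k) = (treeWalks n k ℤ.+ treeWalks n (suc (suc k))) ℤ.+ treeWalks n (suc (suc k))

  walks : ℕ → Fin 2 → Fin 2 → Word → ℤ
  walks n i j u = guard (isPath i j u) (treeWalks n (length u))

  walks-row₀ : ∀ n j u →
    (walks n zero j (unpush (gA , true) u) ℤ.+ walks n zero j (unpush (gA , false) u)) ℤ.+ walks n (suc zero) j (unpush (gB , true) u)
    ≡ walks (suc n) zero j u
  walks-row₀ n zero [] = refl
  walks-row₀ n (suc zero) [] = refl
  walks-row₀ n j ((zero , true) ∷ v) = guard-+-+ (isPath zero j v) _ _ _
  walks-row₀ n j ((zero , false) ∷ v) = guard-+-+-swap₁₂ (isPath zero j v) _ _
  walks-row₀ n j ((suc zero , true) ∷ v) = guard-+-+-swap₁₃ (isPath (suc zero) j v) _ _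
  walks-row₀ n j ((suc zero , false) ∷ v) = refl
  walks-row₀ n j ((suc (suc zero) , _) ∷ v) = refl

  walks-row₁ : ∀ n j u →
    (walks n zero j (unpush (gB , false) u) ℤ.+ walks n (suc zero) j (unpush (gD , true) u)) ℤ.+ walks n (suc zero) j (unpush (gD , false) u)
    ≡ walks (suc n) (suc zero) j u
  walks-row₁ n zero [] = refl
  walks-row₁ n (suc zero) [] = refl
  walks-row₁ n j ((zero , _) ∷ v) = refl
  walks-row₁ n j ((suc zero , true) ∷ v) = refl
  walks-row₁ n j ((suc zero , false) ∷ v) = guard-+-+ (isPath zero j v) _ _ _
  walks-row₁ n j ((suc (suc zero) , true) ∷ v) = guard-+-+-swap₁₂ (isPath (suc zero) j v) _ _
  walks-row₁ n j ((suc (suc zero) , false) ∷ v) = guard-+-+-swap₁₃ (isPath (suc zero) j v) _ _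

  coeff-M^ : ∀ n i j u → reduced u ≡ true → coeff u ((M ^M n) i j) ≡ walks n i j u
  coeff-M^ zero zero zero [] _ = refl
  coeff-M^ zero zero (suc zero) [] _ = refl
  coeff-M^ zero (suc zero) zero [] _ = refl
  coeff-M^ zero (suc zero) (suc zero) [] _ = refl
  coeff-M^ zero zero zero (x ∷ u) _ = sym (guard-0 (isPath zero zero (x ∷ u)))
  coeff-M^ zero zero (suc zero) (x ∷ u) _ = sym (guard-0 (isPath zero (suc zero) (x ∷ u)))
  coeff-M^ zero (suc zero) zero (x ∷ u) _ = sym (guard-0 (isPath (suc zero) zero (x ∷ u)))
  coeff-M^ zero (suc zero) (suc zero) (x ∷ u) _ = sym (guard-0 (isPath (suc zero) (suc zero) (x ∷ u)))
  coeff-M^ (suc n) zero j u r = begin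
    coeff u ((M zero zero *F X₀) ++ (M zero (suc zero) *F X₁))
      ≡⟨ coeff-++ u (M zero zero *F X₀) (M zero (suc zero) *F X₁) ⟩
    coeff u (M zero zero *F X₀) ℤ.+ coeff u (M zero (suc zero) *F X₁)
      ≡⟨ cong (ℤ._+ coeff u (M zero (suc zero) *F X₁)) (coeff-*F-++ u (gen gA) (genInv gA) X₀) ⟩
    (coeff u (letter a *F X₀) ℤ.+ coeff u (letter a⁻ *F X₀)) ℤ.+ coeff u (letter b *F X₁)
      ≡⟨ cong₂ ℤ._+_ (cong₂ ℤ._+_ (step a X₀) (step a⁻ X₀)) (step b X₁) ⟩
    (coeff (unpush a u) X₀ ℤ.+ coeff (unpush a⁻ u) X₀) ℤ.+ coeff (unpush b u) X₁
      ≡⟨ cong₂ ℤ._+_ (cong₂ ℤ._+_ (ih zero a) (ih zero a⁻)) (ih (suc zero) b) ⟩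
    (walks n zero j (unpush a u) ℤ.+ walks n zero j (unpush a⁻ u)) ℤ.+ walks n (suc zero) j (unpush b u)
      ≡⟨ walks-row₀ n j u ⟩
    walks (suc n) zero j u ∎
    where
    open ≡-Reasoning
    X₀ = (M ^M n) zero j
    X₁ = (M ^M n) (suc zero) j
    a = (gA , true); a⁻ = (gA , false); b = (gB , true)
    step : ∀ x X → coeff u (letter x *F X) ≡ coeff (unpush x u) X
    step x X = coeff-letter-*F x u X r
    ih : ∀ i x → coeff (unpush x u) ((M ^M n) i j) ≡ walks n i j (unpush x u)
    ih i x = coeff-M^ n i j (unpush x u) (unpush-reduced x u r)
  coeff-M^ (suc n) (suc zero) j u r = begin
    coeff u ((M (suc zero) zero *F X₀) ++ (M (suc zero) (suc zero) *F X₁))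
      ≡⟨ coeff-++ u (M (suc zero) zero *F X₀) (M (suc zero) (suc zero) *F X₁) ⟩
    coeff u (M (suc zero) zero *F X₀) ℤ.+ coeff u (M (suc zero) (suc zero) *F X₁)
      ≡⟨ cong (λ z → coeff u (M (suc zero) zero *F X₀) ℤ.+ z) (coeff-*F-++ u (gen gD) (genInv gD) X₁) ⟩
    coeff u (letter b⁻ *F X₀) ℤ.+ (coeff u (letter d *F X₁) ℤ.+ coeff u (letter d⁻ *F X₁))
      ≡⟨ ℤ.+-assoc (coeff u (letter b⁻ *F X₀)) _ _ ⟨
    (coeff u (letter b⁻ *F X₀) ℤ.+ coeff u (letter d *F X₁)) ℤ.+ coeff u (letter d⁻ *F X₁)
      ≡⟨ cong₂ ℤ._+_ (cong₂ ℤ._+_ (step b⁻ X₀) (step d X₁)) (step d⁻ X₁) ⟩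
    (coeff (unpush b⁻ u) X₀ ℤ.+ coeff (unpush d u) X₁) ℤ.+ coeff (unpush d⁻ u) X₁
      ≡⟨ cong₂ ℤ._+_ (cong₂ ℤ._+_ (ih zero b⁻) (ih (suc zero) d)) (ih (suc zero) d⁻) ⟩
    (walks n zero j (unpush b⁻ u) ℤ.+ walks n (suc zero) j (unpush d u)) ℤ.+ walks n (suc zero) j (unpush d⁻ u)
      ≡⟨ walks-row₁ n j u ⟩
    walks (suc n) (suc zero) j u ∎
    where
    open ≡-Reasoning
    X₀ = (M ^M n) zero j
    X₁ = (M ^M n) (suc zero) j
    b⁻ = (gB , false); d = (gD , true); d⁻ = (gD , false)
    step : ∀ x X → coeff u (letter x *F X) ≡ coeff (unpush x u) X
    step x X = coeff-letter-*F x u X r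
    ih : ∀ i x → coeff (unpush x u) ((M ^M n) i j) ≡ walks n i j (unpush x u)
    ih i x = coeff-M^ n i j (unpush x u) (unpush-reduced x u r)

  aCoeff-M : ∀ n → aCoeff M n ≡ treeWalks n 0 ℤ.+ treeWalks n 0
  aCoeff-M n = begin
    coeffId (Tr (M ^M n))                                           ≡⟨ coeffId≡coeff[] (Tr (M ^M n)) ⟩
    coeff [] ((M ^M n) zero zero ++ (M ^M n) (suc zero) (suc zero)) ≡⟨ coeff-++ [] ((M ^M n) zero zero) _ ⟩
    coeff [] ((M ^M n) zero zero) ℤ.+ coeff [] ((M ^M n) (suc zero) (suc zero))
      ≡⟨ cong₂ ℤ._+_ (coeff-M^ n zero zero [] refl) (coeff-M^ n (suc zero) (suc zero) [] refl) ⟩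
    treeWalks n 0 ℤ.+ treeWalks n 0 ∎
    where open ≡-Reasoning

module TraceSeries where

  open import Data.Nat as ℕ using (ℕ; zero; suc; z≤n; s≤s)
  open import Data.Integer as ℤ using (+_)
  open import Data.Rational using (0ℚ; 1ℚ; _+_; _*_; -_)
  open import Data.Rational.Properties
  open import Relation.Binary.PropositionalEquality
  open import Tactic.RingSolver using (solve-∀)
  open import Defs
  open Rationals
  open PowerSeries
  open SquareRoot
  open TreeWalks

  t : Series
  t = t^ 1

  Y : Series
  Y = t ⊛ catalan

  walkSeries : ℕ → Series
  walkSeries k n = fromℤ (treeWalks n k)

  Y-equation : Y ≋ (t ⊕ (cst (+ 2) ⊛ (t ⊛ (Y ⊛ Y))))
  Y-equation = ≋-by-remainder {Y} {t ⊕ (cst (+ 2) ⊛ (t ⊛ (Y ⊛ Y)))}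
    (solve 3 (λ c t x →
        t :* c := (t :+ con (+ 2) :* (t :* ((t :* c) :* (t :* c))))
                  :+ (t :* (c :- (con (+ 1) :+ con (+ 2) :* (x :* (c :* c))))
                      :+ (con (+ 2) :* (t :* (c :* c))) :* (x :- t :* t)))
      (λ _ → refl) catalan t t²)
    (⊕-≋0 (⊛-≋0 t (≋⇒difference≋0 catalan-equation)) (⊛-≋0 (cst (+ 2) ⊛ (t ⊛ (catalan ⊛ catalan))) (≋⇒difference≋0 (t^-+ 1 1))))

  Y-⊛ : ∀ P → (Y ⊛ P) ≋ (t ⊛ (P ⊕ (cst (+ 2) ⊛ (Y ⊛ (Y ⊛ P)))))
  Y-⊛ P n = trans (⊛-cong {Y} {t ⊕ (cst (+ 2) ⊛ (t ⊛ (Y ⊛ Y)))} {P} {P} Y-equation (λ _ → refl) n)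
    (solve 3 (λ y t p → (t :+ con (+ 2) :* (t :* (y :* y))) :* p := t :* (p :+ con (+ 2) :* (y :* (y :* p))))
       (λ _ → refl) Y t P n)

  walkSeries≋Y^⊛ : ∀ n k → walkSeries k n ≡ (powS Y k ⊛ walkSeries 0) n
  walkSeries≋Y^⊛ n zero = sym (trans (⊛-cong {powS Y 0} {series1} {R} {R} (powS-zero Y) (λ _ → refl) n) (⊛-identityˡ R n))
    where R = walkSeries 0
  walkSeries≋Y^⊛ zero (suc k) = sym (trans (cong (λ y → (y * powS Y k 0) * walkSeries 0 0) (mono-⊛-below 1ℚ 1 catalan 0 (s≤s z≤n)))
    (trans (cong (_* walkSeries 0 0) (*-zeroˡ (powS Y k 0))) (*-zeroˡ (walkSeries 0 0))))
  walkSeries≋Y^⊛ (suc n) (suc k) = sym (begin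
    ((Y ⊛ P) ⊛ R) (suc n)              ≡⟨ ⊛-cong {Y ⊛ P} {t ⊛ Z} {R} {R} (Y-⊛ P) (λ _ → refl) (suc n) ⟩
    ((t ⊛ Z) ⊛ R) (suc n)              ≡⟨ ⊛-assoc t Z R (suc n) ⟩
    (t ⊛ (Z ⊛ R)) (1 ℕ.+ n)            ≡⟨ mono-⊛-shift 1ℚ 1 (Z ⊛ R) n ⟩
    1ℚ * (Z ⊛ R) n                     ≡⟨ *-identityˡ _ ⟩
    (Z ⊛ R) n
      ≡⟨ solve 3 (λ p y r → (p :+ con (+ 2) :* (y :* (y :* p))) :* r := p :* r :+ con (+ 2) :* ((y :* (y :* p)) :* r))
           (λ _ → refl) P Y R n ⟩
    (P ⊛ R) n + (cst (+ 2) ⊛ (powS Y (2 ℕ.+ k) ⊛ R)) n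
      ≡⟨ cong (λ x → (P ⊛ R) n + x) (const-⊛ (fromℤ (+ 2)) (powS Y (2 ℕ.+ k) ⊛ R) n) ⟩
    (P ⊛ R) n + fromℤ (+ 2) * (powS Y (2 ℕ.+ k) ⊛ R) n
      ≡⟨ cong₂ (λ a b → a + fromℤ (+ 2) * b) (walkSeries≋Y^⊛ n k) (walkSeries≋Y^⊛ n (2 ℕ.+ k)) ⟨
    fromℤ p + fromℤ (+ 2) * fromℤ q
      ≡⟨ double-last (fromℤ p) (fromℤ q) ⟨
    (fromℤ p + fromℤ q) + fromℤ q
      ≡⟨ trans (fromℤ-+ (p ℤ.+ q) q) (cong (_+ fromℤ q) (fromℤ-+ p q)) ⟨
    fromℤ ((p ℤ.+ q) ℤ.+ q)            ∎)
    where
    open ≡-Reasoning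
    P = powS Y k
    R = walkSeries 0
    Z = P ⊕ (cst (+ 2) ⊛ (Y ⊛ (Y ⊛ P)))
    p = treeWalks n k
    q = treeWalks n (2 ℕ.+ k)
    double-last : ∀ a b → (a + b) + b ≡ a + fromℤ (+ 2) * b
    double-last = solve-∀ ℚ-ring

  walkSeries-1≋Y⊛walkSeries-0 : walkSeries 1 ≋ (Y ⊛ walkSeries 0)
  walkSeries-1≋Y⊛walkSeries-0 n = trans (walkSeries≋Y^⊛ n 1) (⊛-cong {powS Y 1} {Y} {walkSeries 0} {walkSeries 0} Y⊛1≋Y (λ _ → refl) n)
    where
    Y⊛1≋Y : (Y ⊛ powS Y 0) ≋ Y
    Y⊛1≋Y k = trans (⊛-cong {Y} {Y} {powS Y 0} {series1} (λ _ → refl) (powS-zero Y) k)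
                    (trans (⊛-comm Y series1 k) (⊛-identityˡ Y k))

  walkSeries-0-equation : walkSeries 0 ≋ (series1 ⊕ (cst (+ 3) ⊛ (t² ⊛ (catalan ⊛ walkSeries 0))))
  walkSeries-0-equation = ≋-by-remainder {R} {series1 ⊕ (cst (+ 3) ⊛ (t² ⊛ (catalan ⊛ R)))}
    (solve 5 (λ r w c t x →
        r := (con (+ 1) :+ con (+ 3) :* (x :* (c :* r)))
             :+ ((r :- (con (+ 1) :+ con (+ 3) :* (t :* w)))
                 :+ ((con (+ 3) :* t) :* (w :- (t :* c) :* r) :+ (:- (con (+ 3) :* (c :* r))) :* (x :- t :* t))))
      (λ _ → refl) R (walkSeries 1) catalan t t²)
    (⊕-≋0 (≋⇒difference≋0 shifted)
          (⊕-≋0 (⊛-≋0 (cst (+ 3) ⊛ t) (≋⇒difference≋0 walkSeries-1≋Y⊛walkSeries-0))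
                (⊛-≋0 (negS (cst (+ 3) ⊛ (catalan ⊛ R))) (≋⇒difference≋0 (t^-+ 1 1)))))
    where
    R = walkSeries 0
    shifted : R ≋ (series1 ⊕ (cst (+ 3) ⊛ (t ⊛ walkSeries 1)))
    shifted zero = refl
    shifted (suc n) = sym (begin
      0ℚ + (cst (+ 3) ⊛ (t ⊛ walkSeries 1)) (suc n)  ≡⟨ +-identityˡ _ ⟩
      (cst (+ 3) ⊛ (t ⊛ walkSeries 1)) (suc n)       ≡⟨ const-⊛ (fromℤ (+ 3)) (t ⊛ walkSeries 1) (suc n) ⟩
      fromℤ (+ 3) * (t ⊛ walkSeries 1) (1 ℕ.+ n)     ≡⟨ cong (fromℤ (+ 3) *_) (trans (mono-⊛-shift 1ℚ 1 (walkSeries 1) n) (*-identityˡ (fromℤ p))) ⟩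
      fromℤ (+ 3) * fromℤ p                          ≡⟨ triple (fromℤ p) ⟩
      (fromℤ p + fromℤ p) + fromℤ p                  ≡⟨ trans (fromℤ-+ (p ℤ.+ p) p) (cong (_+ fromℤ p) (fromℤ-+ p p)) ⟨
      fromℤ ((p ℤ.+ p) ℤ.+ p)                        ∎)
      where
      open ≡-Reasoning
      p = treeWalks n 1
      triple : ∀ a → fromℤ (+ 3) * a ≡ (a + a) + a
      triple = solve-∀ ℚ-ring

  gS-M≋walkSeries : gS M ≋ (cst (+ 2) ⊛ (walkSeries 0 ⊕ negS series1))
  gS-M≋walkSeries zero = refl
  gS-M≋walkSeries (suc n) = begin
    fromℤ (aCoeff M (suc n))                      ≡⟨ cong fromℤ (aCoeff-M (suc n)) ⟩
    fromℤ (w ℤ.+ w)                               ≡⟨ fromℤ-+ w w ⟩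
    fromℤ w + fromℤ w                             ≡⟨ twice (fromℤ w) ⟩
    fromℤ (+ 2) * (fromℤ w + - 0ℚ)                ≡⟨ const-⊛ (fromℤ (+ 2)) (walkSeries 0 ⊕ negS series1) (suc n) ⟨
    (cst (+ 2) ⊛ (walkSeries 0 ⊕ negS series1)) (suc n) ∎
    where
    open ≡-Reasoning
    w = treeWalks (suc n) 0
    twice : ∀ a → a + a ≡ fromℤ (+ 2) * (a + - 0ℚ)
    twice = solve-∀ ℚ-ring

  1-9t² : Series
  1-9t² = series1 ⊕ negS (cst (+ 9) ⊛ t²)

  catalan⊛walkSeries⊛1-9t² : (catalan ⊛ (walkSeries 0 ⊛ 1-9t²)) ≋ (cst (+ 3) ⊕ negS (cst (+ 2) ⊛ catalan))
  catalan⊛walkSeries⊛1-9t² = difference≋0⇒≋ (⊛-unit-cancelʳ E (series1 ⊕ negS (cst (+ 3) ⊛ (t² ⊛ C))) refl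
    (λ n → trans (identity n) (remainder≋0 n)))
    where
    C = catalan
    R = walkSeries 0
    E = (C ⊛ (R ⊛ 1-9t²)) ⊕ negS (cst (+ 3) ⊕ negS (cst (+ 2) ⊛ C))
    remainder = (cst (+ 3) ⊛ (C ⊕ negS (series1 ⊕ (cst (+ 2) ⊛ (t² ⊛ (C ⊛ C))))))
                ⊕ ((C ⊛ 1-9t²) ⊛ (R ⊕ negS (series1 ⊕ (cst (+ 3) ⊛ (t² ⊛ (C ⊛ R))))))
    identity : (E ⊛ (series1 ⊕ negS (cst (+ 3) ⊛ (t² ⊛ C)))) ≋ remainder
    identity = solve 3 (λ c r x →
          (c :* (r :* (con (+ 1) :- con (+ 9) :* x)) :- (con (+ 3) :- con (+ 2) :* c)) :* (con (+ 1) :- con (+ 3) :* (x :* c))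
          := con (+ 3) :* (c :- (con (+ 1) :+ con (+ 2) :* (x :* (c :* c))))
             :+ (c :* (con (+ 1) :- con (+ 9) :* x)) :* (r :- (con (+ 1) :+ con (+ 3) :* (x :* (c :* r)))))
        (λ _ → refl) C R t²
    remainder≋0 : remainder ≋ 0S
    remainder≋0 = ⊕-≋0 (⊛-≋0 (cst (+ 3)) (≋⇒difference≋0 catalan-equation))
                       (⊛-≋0 (C ⊛ 1-9t²) (≋⇒difference≋0 walkSeries-0-equation))

  gS-M-1-9t² : (gS M ⊛ 1-9t²) ≋ (cst (+ 3) ⊛ ((sqrt18 ⊕ negS series1) ⊕ (cst (+ 6) ⊛ t²)))
  gS-M-1-9t² = ≋-by-remainder {gS M ⊛ 1-9t²} {cst (+ 3) ⊛ F} identity remainder≋0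
    where
    S = sqrt18
    C = catalan
    R = walkSeries 0
    F = (S ⊕ negS series1) ⊕ (cst (+ 6) ⊛ t²)
    hg = gS M ⊕ negS (cst (+ 2) ⊛ (R ⊕ negS series1))
    hS = S ⊕ negS (series1 ⊕ (cst (ℤ.- (+ 4)) ⊛ (t² ⊛ C)))
    hR = R ⊕ negS (series1 ⊕ (cst (+ 3) ⊛ (t² ⊛ (C ⊛ R))))
    E = (C ⊛ (R ⊛ 1-9t²)) ⊕ negS (cst (+ 3) ⊕ negS (cst (+ 2) ⊛ C))
    remainder = ((((cst (+ 6) ⊛ t²) ⊛ E) ⊕ ((cst (+ 2) ⊛ 1-9t²) ⊛ hR)) ⊕ (1-9t² ⊛ hg)) ⊕ negS (cst (+ 3) ⊛ hS)
    identity : (gS M ⊛ 1-9t²) ≋ ((cst (+ 3) ⊛ F) ⊕ remainder)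
    identity = solve 5 (λ g s c r x →
        let 1-9x = con (+ 1) :- con (+ 9) :* x in
        g :* 1-9x
        := con (+ 3) :* ((s :- con (+ 1)) :+ con (+ 6) :* x)
           :+ ((((con (+ 6) :* x) :* ((c :* (r :* 1-9x)) :- (con (+ 3) :- con (+ 2) :* c))
                 :+ (con (+ 2) :* 1-9x) :* (r :- (con (+ 1) :+ con (+ 3) :* (x :* (c :* r)))))
                :+ 1-9x :* (g :- con (+ 2) :* (r :- con (+ 1))))
               :- con (+ 3) :* (s :- (con (+ 1) :+ con (ℤ.- (+ 4)) :* (x :* c)))))
      (λ _ → refl) (gS M) S C R t²
    remainder≋0 : remainder ≋ 0S
    remainder≋0 = ⊕-≋0 (⊕-≋0 (⊕-≋0 (⊛-≋0 (cst (+ 6) ⊛ t²) (≋⇒difference≋0 catalan⊛walkSeries⊛1-9t²))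
                                    (⊛-≋0 (cst (+ 2) ⊛ 1-9t²) (≋⇒difference≋0 walkSeries-0-equation)))
                              (⊛-≋0 1-9t² (≋⇒difference≋0 gS-M≋walkSeries)))
                       (λ n → cong -_ (⊛-≋0 (cst (+ 3)) (≋⇒difference≋0 sqrt18≋1-4t²catalan) n))

  gS-M-equation : (n : ℕ) → (gS M ⊛ (series1 ⊖ mono (fromℕ 9) 2)) n
                            ≡ scale (fromℕ 3) ((sqrt18 ⊖ series1) ⊕ mono (fromℕ 6) 2) n
  gS-M-equation n = begin
    (gS M ⊛ (series1 ⊖ mono (fromℕ 9) 2)) n
      ≡⟨ ⊛-cong {gS M} {gS M} {series1 ⊖ mono (fromℕ 9) 2} {1-9t²} (λ _ → refl)
                (λ k → cong (λ x → series1 k + - x) (mono≋cst⊛t^ (+ 9) 2 k)) n ⟩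
    (gS M ⊛ 1-9t²) n
      ≡⟨ gS-M-1-9t² n ⟩
    (cst (+ 3) ⊛ F) n
      ≡⟨ const-⊛ (fromℤ (+ 3)) F n ⟩
    fromℕ 3 * F n
      ≡⟨ cong (λ x → fromℕ 3 * ((sqrt18 n + - series1 n) + x)) (mono≋cst⊛t^ (+ 6) 2 n) ⟨
    scale (fromℕ 3) ((sqrt18 ⊖ series1) ⊕ mono (fromℕ 6) 2) n ∎
    where
    open ≡-Reasoning
    F = (sqrt18 ⊕ negS series1) ⊕ (cst (+ 6) ⊛ t²)

module ExpTraceSeries where

  open import Data.Nat as ℕ using (ℕ; zero; suc; s≤s)
  open import Data.Integer as ℤ using (+_)
  open import Data.Rational as ℚ using (0ℚ; 1ℚ; _+_; _*_; -_)
  open import Data.Rational.Properties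
  open import Relation.Binary.PropositionalEquality
  open import Defs
  open Rationals
  open PowerSeries
  open EulerOperator
  open SquareRoot
  open TraceSeries
  open Exponential

  θ-logP : θ (logP M) ≋ gS M
  θ-logP zero = refl
  θ-logP (suc n) = fromℕ-*-/ (aCoeff M (suc n)) n

  θ-PS : θ (PS M) ≋ (gS M ⊛ PS M)
  θ-PS n = trans (θ-expS (logP M) refl n) (⊛-cong {θ (logP M)} {gS M} {PS M} {PS M} θ-logP (λ _ → refl) n)

  N : Series
  N = ((pow32-18 ⊖ series1) ⊕ mono (fromℕ 12) 2) ⊖ mono (fromℕ 24) 4

  -- Q = N / 32t⁶, the closed form claimed for P_M.
  Q : Series
  Q n = (+ 1) ℚ./ 32 * N (6 ℕ.+ n)

  N≋mono⊛Q : N ≋ (mono (fromℕ 32) 6 ⊛ Q)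
  N≋mono⊛Q = ≋-mono-⊛ (fromℕ 32) 6 {N} {Q} below shifted
    where
    below : ∀ n → n ℕ.< 6 → N n ≡ 0ℚ
    below 0 _ = refl
    below 1 _ = refl
    below 2 _ = refl
    below 3 _ = refl
    below 4 _ = refl
    below 5 _ = refl
    below (suc (suc (suc (suc (suc (suc n)))))) (s≤s (s≤s (s≤s (s≤s (s≤s (s≤s ()))))))
    shifted : ∀ n → N (6 ℕ.+ n) ≡ fromℕ 32 * Q n
    shifted n = sym (trans (sym (*-assoc (fromℕ 32) ((+ 1) ℚ./ 32) (N (6 ℕ.+ n)))) (*-identityˡ (N (6 ℕ.+ n))))

  N₀ : Series
  N₀ = (((1-8t² ⊛ sqrt18) ⊕ negS series1) ⊕ (cst (+ 12) ⊛ t²)) ⊕ negS (cst (+ 24) ⊛ t^ 4)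

  N≋N₀ : N ≋ N₀
  N≋N₀ n = cong₂ (λ a b → a + - b)
    (cong₂ _+_ (cong (_+ - series1 n) (pow32-18≋1-8t²⊛sqrt18 n)) (mono≋cst⊛t^ (+ 12) 2 n))
    (mono≋cst⊛t^ (+ 24) 4 n)

  θN₀ : Series
  θN₀ = ((((cst (ℤ.- (+ 16)) ⊛ t²) ⊛ sqrt18) ⊕ (1-8t² ⊛ θ sqrt18)) ⊕ (cst (+ 24) ⊛ t²)) ⊕ negS (cst (+ 96) ⊛ t^ 4)

  θN≋θN₀ : θ N ≋ θN₀
  θN≋θN₀ n = begin
    θ N n
      ≡⟨ θ-cong N≋N₀ n ⟩
    θ N₀ n
      ≡⟨ θ-⊕ N₁ (negS (cst (+ 24) ⊛ t^ 4)) n ⟩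
    θ N₁ n + θ (negS (cst (+ 24) ⊛ t^ 4)) n
      ≡⟨ cong₂ _+_ (trans (θ-⊕ ((1-8t² ⊛ sqrt18) ⊕ negS series1) (cst (+ 12) ⊛ t²) n) (cong₂ _+_ (θ-⊕ (1-8t² ⊛ sqrt18) (negS series1) n) (θ-cst⊛t^ (+ 12) 2 n)))
                   (trans (θ-negS (cst (+ 24) ⊛ t^ 4) n) (cong -_ (θ-cst⊛t^ (+ 24) 4 n))) ⟩
    ((θ (1-8t² ⊛ sqrt18) n + θ (negS series1) n) + (cst (+ 24) ⊛ t²) n) + - (cst (+ 96) ⊛ t^ 4) n
      ≡⟨ cong (λ x → ((x + θ (negS series1) n) + (cst (+ 24) ⊛ t²) n) + - (cst (+ 96) ⊛ t^ 4) n)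
              (trans (θ-⊛ 1-8t² sqrt18 n) (cong (_+ (1-8t² ⊛ θ sqrt18) n)
                     (⊛-cong {θ 1-8t²} {cst (ℤ.- (+ 16)) ⊛ t²} {sqrt18} {sqrt18} θ-1-8t² (λ _ → refl) n))) ⟩
    ((θ₀ + θ (negS series1) n) + (cst (+ 24) ⊛ t²) n) + - (cst (+ 96) ⊛ t^ 4) n
      ≡⟨ cong (λ x → ((θ₀ + x) + (cst (+ 24) ⊛ t²) n) + - (cst (+ 96) ⊛ t^ 4) n)
              (trans (θ-negS series1 n) (cong -_ (θ-const 1ℚ n))) ⟩
    ((θ₀ + - 0ℚ) + (cst (+ 24) ⊛ t²) n) + - (cst (+ 96) ⊛ t^ 4) n
      ≡⟨ cong (λ x → (x + (cst (+ 24) ⊛ t²) n) + - (cst (+ 96) ⊛ t^ 4) n) (+-identityʳ θ₀) ⟩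
    θN₀ n ∎
    where
    open ≡-Reasoning
    N₁ = ((1-8t² ⊛ sqrt18) ⊕ negS series1) ⊕ (cst (+ 12) ⊛ t²)
    θ₀ = (((cst (ℤ.- (+ 16)) ⊛ t²) ⊛ sqrt18) ⊕ (1-8t² ⊛ θ sqrt18)) n

  N≋t⁶Q : N ≋ ((cst (+ 32) ⊛ t^ 6) ⊛ Q)
  N≋t⁶Q n = trans (N≋mono⊛Q n) (⊛-cong {mono (fromℕ 32) 6} {cst (+ 32) ⊛ t^ 6} {Q} {Q} (mono≋cst⊛t^ (+ 32) 6) (λ _ → refl) n)

  θN≋θt⁶Q : θ N ≋ (((cst (+ 192) ⊛ t^ 6) ⊛ Q) ⊕ ((cst (+ 32) ⊛ t^ 6) ⊛ θ Q))
  θN≋θt⁶Q n = trans (θ-cong N≋t⁶Q n) (trans (θ-⊛ (cst (+ 32) ⊛ t^ 6) Q n)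
    (cong (_+ ((cst (+ 32) ⊛ t^ 6) ⊛ θ Q) n) (⊛-cong {θ (cst (+ 32) ⊛ t^ 6)} {cst (+ 192) ⊛ t^ 6} {Q} {Q} (θ-cst⊛t^ (+ 32) 6) (λ _ → refl) n)))

  θ-Q-equation : (1-9t² ⊛ θ Q) ≋ (1-9t² ⊛ (gS M ⊛ Q))
  θ-Q-equation = difference≋0⇒≋ (cst-⊛-cancel 31 D (t^-⊛-cancel 6 (cst (+ 32) ⊛ D) (λ n → trans (identity n) (remainder≋0 n))))
    where
    S = sqrt18
    g = gS M
    D = (1-9t² ⊛ θ Q) ⊕ negS (1-9t² ⊛ (g ⊛ Q))
    h₁ = N ⊕ negS ((cst (+ 32) ⊛ t^ 6) ⊛ Q)
    h₂ = θ N ⊕ negS (((cst (+ 192) ⊛ t^ 6) ⊛ Q) ⊕ ((cst (+ 32) ⊛ t^ 6) ⊛ θ Q))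
    h₃ = N ⊕ negS N₀
    h₄ = θ N ⊕ negS θN₀
    h₅ = (1-8t² ⊛ θ S) ⊕ negS ((cst (ℤ.- (+ 8)) ⊛ t²) ⊛ S)
    h₆ = (S ⊛ S) ⊕ negS 1-8t²
    h₇ = (g ⊛ 1-9t²) ⊕ negS (cst (+ 3) ⊛ ((S ⊕ negS series1) ⊕ (cst (+ 6) ⊛ t²)))
    h₈ = t^ 4 ⊕ negS (t² ⊛ t²)
    remainder = ((((((((1-9t² ⊛ (cst (+ 6) ⊕ g)) ⊛ h₁) ⊕ (negS 1-9t² ⊛ h₂))
                     ⊕ (negS ((cst (+ 3) ⊕ (cst (+ 3) ⊛ S)) ⊕ negS (cst (+ 36) ⊛ t²)) ⊛ h₃))
                    ⊕ (1-9t² ⊛ h₄)) ⊕ (1-9t² ⊛ h₅))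
                 ⊕ (negS (cst (+ 3) ⊛ 1-8t²) ⊛ h₆)) ⊕ (negS N ⊛ h₇))
                ⊕ (((cst (+ 72) ⊛ S) ⊕ negS (cst (+ 24))) ⊛ h₈)
    identity : (t^ 6 ⊛ (cst (+ 32) ⊛ D)) ≋ remainder
    identity = solve 10 (λ q θq g s θs n θn x y z →
        let 1-9x = con (+ 1) :- con (+ 9) :* x
            1-8x = con (+ 1) :+ con (ℤ.- (+ 8)) :* x
        in
        z :* (con (+ 32) :* (1-9x :* θq :- 1-9x :* (g :* q)))
        := ((((((((1-9x :* (con (+ 6) :+ g)) :* (n :- (con (+ 32) :* z) :* q))
                 :+ (:- 1-9x) :* (θn :- ((con (+ 192) :* z) :* q :+ (con (+ 32) :* z) :* θq)))
                :+ (:- ((con (+ 3) :+ con (+ 3) :* s) :- con (+ 36) :* x))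
                   :* (n :- ((((1-8x :* s) :- con (+ 1)) :+ con (+ 12) :* x) :- con (+ 24) :* y)))
               :+ 1-9x :* (θn :- ((((con (ℤ.- (+ 16)) :* x) :* s :+ 1-8x :* θs) :+ con (+ 24) :* x) :- con (+ 96) :* y)))
              :+ 1-9x :* (1-8x :* θs :- (con (ℤ.- (+ 8)) :* x) :* s))
             :+ (:- (con (+ 3) :* 1-8x)) :* (s :* s :- 1-8x))
            :+ (:- n) :* (g :* 1-9x :- con (+ 3) :* ((s :- con (+ 1)) :+ con (+ 6) :* x)))
           :+ ((con (+ 72) :* s) :- con (+ 24)) :* (y :- x :* x))
      (λ _ → refl) Q (θ Q) g S (θ S) N (θ N) t² (t^ 4) (t^ 6)
    remainder≋0 : remainder ≋ 0S
    remainder≋0 =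
      ⊕-≋0 (⊕-≋0 (⊕-≋0 (⊕-≋0 (⊕-≋0 (⊕-≋0 (⊕-≋0
        (⊛-≋0 (1-9t² ⊛ (cst (+ 6) ⊕ g)) (≋⇒difference≋0 N≋t⁶Q))
        (⊛-≋0 (negS 1-9t²) (≋⇒difference≋0 θN≋θt⁶Q)))
        (⊛-≋0 (negS ((cst (+ 3) ⊕ (cst (+ 3) ⊛ S)) ⊕ negS (cst (+ 36) ⊛ t²))) (≋⇒difference≋0 N≋N₀)))
        (⊛-≋0 1-9t² (≋⇒difference≋0 θN≋θN₀)))
        (⊛-≋0 1-9t² (≋⇒difference≋0 θ-sqrt18)))
        (⊛-≋0 (negS (cst (+ 3) ⊛ 1-8t²)) (≋⇒difference≋0 sqrt18-squared)))
        (⊛-≋0 (negS N) (≋⇒difference≋0 gS-M-1-9t²)))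
        (⊛-≋0 ((cst (+ 72) ⊛ S) ⊕ negS (cst (+ 24))) (≋⇒difference≋0 (t^-+ 2 2)))

  PS-M≋Q : PS M ≋ Q
  PS-M≋Q = difference≋0⇒≋ (θ-equation-unique 1-9t² (1-9t² ⊛ g) D refl refl refl θD-equation)
    where
    g = gS M
    P = PS M
    D = P ⊕ negS Q
    identity : (1-9t² ⊛ (θ P ⊕ negS (θ Q))) ≋ (((1-9t² ⊛ g) ⊛ D) ⊕ ((1-9t² ⊛ (θ P ⊕ negS (g ⊛ P))) ⊕ negS ((1-9t² ⊛ θ Q) ⊕ negS (1-9t² ⊛ (g ⊛ Q)))))
    identity = solve 6 (λ a g p q θp θq →
        a :* (θp :- θq) := (a :* g) :* (p :- q) :+ (a :* (θp :- g :* p) :- (a :* θq :- a :* (g :* q))))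
      (λ _ → refl) 1-9t² g P Q (θ P) (θ Q)
    θD-equation : (1-9t² ⊛ θ D) ≋ ((1-9t² ⊛ g) ⊛ D)
    θD-equation = ≋-by-remainder {1-9t² ⊛ θ D} {(1-9t² ⊛ g) ⊛ D}
      (λ n → trans (⊛-cong {1-9t²} {1-9t²} {θ D} {θ P ⊕ negS (θ Q)} (λ _ → refl)
                     (λ k → trans (θ-⊕ P (negS Q) k) (cong (λ x → θ P k + x) (θ-negS Q k))) n)
                   (identity n))
      (⊕-≋0 (⊛-≋0 1-9t² (≋⇒difference≋0 θ-PS)) (λ n → cong -_ (≋⇒difference≋0 θ-Q-equation n)))

  PS-M-equation : (n : ℕ) → (mono (fromℕ 32) 6 ⊛ PS M) n
                            ≡ (((pow32-18 ⊖ series1) ⊕ mono (fromℕ 12) 2) ⊖ mono (fromℕ 24) 4) n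
  PS-M-equation n = trans (⊛-cong {mono (fromℕ 32) 6} {mono (fromℕ 32) 6} {PS M} {Q} (λ _ → refl) PS-M≋Q n)
                          (sym (N≋mono⊛Q n))

open TraceSeries using (gS-M-equation)
open ExpTraceSeries using (PS-M-equation)

proposition5p1 :
    ((n : ℕ) → (gS M ⊛ (series1 ⊖ mono (fromℕ 9) 2)) n
                 ≡ scale (fromℕ 3) ((sqrt18 ⊖ series1) ⊕ mono (fromℕ 6) 2) n)
    × ((n : ℕ) → (mono (fromℕ 32) 6 ⊛ PS M) n
                 ≡ (((pow32-18 ⊖ series1) ⊕ mono (fromℕ 12) 2) ⊖ mono (fromℕ 24) 4) n)
proposition5p1 = gS-M-equation , PS-M-equation
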